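{- Let $m\in\mathbb{Q}$ and $n\geq 2$, and let $f^{(n)}_m(X)$ be as defined in the context. Then the resultant of $f^{(n)}_m(X)$ and $f^{(n-1)}_m(X)$ with respect to $X$ is $$\operatorname{res}\left(f^{(n)}_m(X),f^{(n-1)}_m(X)\right)=(m^2+m+1)^{n-1}\cdot 3^{\frac{(n-1)(n-2)}{2}}\cdot(-1)^{\frac{n(n-1)}{2}}.$$
   Context: For a rational number $m$ define $g:\mathbb{N}\to\mathbb{Q}$ by $g(i)=1,\,-m,\,-m-1,\,-1,\,m,\,m+1$ according as $i\equiv 0,1,2,3,4,5 \pmod 6$. For $n\geq 0$ put $f^{(n)}_m(X)=\sum_{i=0}^{n}\binom{n}{i}X^i g(n-i)$ (a monic polynomial of degree $n$). The resultant is the standard (Sylvester) resultant: for $A=a\prod_{i}(X-\alpha_i)$ of degree $k$ and $B=b\prod_j(X-\beta_j)$ of degree $l$, $\operatorname{res}(A,B)=a^{l}b^{k}\prod_{i,j}(\alpha_i-\beta_j)$. -}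

module Defs where

open import Data.Nat as ℕ using (ℕ; zero; suc; _∸_; _≤?_; _<?_)
open import Data.Nat.Combinatorics using (_C_)
open import Data.Integer using (+_)
open import Data.Rational using (ℚ; 0ℚ; 1ℚ; _+_; _*_; -_; _/_)
open import Data.Fin using (Fin; toℕ; punchIn)
import Data.Fin as Fin
open import Relation.Nullary using (yes; no)

ℕ→ℚ : ℕ → ℚ
ℕ→ℚ k = + k / 1

_^ℚ_ : ℚ → ℕ → ℚ
x ^ℚ zero = 1ℚ
x ^ℚ suc k = x * (x ^ℚ k)

g : ℚ → ℕ → ℚ
g m 0 = 1ℚ
g m 1 = - m
g m 2 = - m + - 1ℚ
g m 3 = - 1ℚ
g m 4 = m
g m 5 = m + 1ℚ
g m (suc (suc (suc (suc (suc (suc i)))))) = g m i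

-- coefficient of X^i in f^{(n)}_m(X) = Σ_{i=0}^n binom(n,i) X^i g(n-i)
f : ℚ → ℕ → ℕ → ℚ
f m n i with i ℕ.≤? n
... | yes _ = ℕ→ℚ (n C i) * g m (n ∸ i)
... | no _ = 0ℚ

sumFin : (k : ℕ) → (Fin k → ℚ) → ℚ
sumFin zero h = 0ℚ
sumFin (suc k) h = h Fin.zero + sumFin k (λ j → h (Fin.suc j))

det : (k : ℕ) → (Fin k → Fin k → ℚ) → ℚ
det zero M = 1ℚ
det (suc k) M =
  sumFin (suc k) (λ j → ((- 1ℚ) ^ℚ toℕ j) * M Fin.zero j
                        * det k (λ r c → M (Fin.suc r) (punchIn j c)))

-- Sylvester matrix of A = Σ_{i≤k} A i X^i (degree k) and B = Σ_{i≤l} B i X^i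
-- (degree l): a (k+l)×(k+l) matrix; rows 0..l-1 contain the coefficients
-- A k, A (k-1), ..., A 0 shifted right by the row index; rows l..l+k-1
-- contain B l, ..., B 0 shifted right by (row index - l).
sylvester : (k l : ℕ) → (ℕ → ℚ) → (ℕ → ℚ) → Fin (k ℕ.+ l) → Fin (k ℕ.+ l) → ℚ
sylvester k l A B r c = entry (toℕ r) (toℕ c)
  where
  band : ℕ → (ℕ → ℚ) → ℕ → ℕ → ℚ
  band d P s c' with s ℕ.≤? c'
  ... | no _ = 0ℚ
  ... | yes _ with c' ∸ s ℕ.≤? d
  ...   | yes _ = P (d ∸ (c' ∸ s))
  ...   | no _ = 0ℚ
  entry : ℕ → ℕ → ℚ
  entry r' c' with r' ℕ.<? l
  ... | yes _ = band k A r' c'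
  ... | no _ = band l B (r' ∸ l) c'

res : (k l : ℕ) → (ℕ → ℚ) → (ℕ → ℚ) → ℚ
res k l A B = det (k ℕ.+ l) (sylvester k l A B)

{-# OPTIONS --safe #-}
module Submission where

-- Over ℚ[ω], ω a primitive sixth root of unity, g m i = a ω^i + b ω̄^i for suitable a, b, so that
-- f^(n) = F n with F n = a (X + ω)^n + b (X + ω̄)^n. Since F (k + 1) = (X + ω̄) F k + a (ω - ω̄) (X + ω)^k,
-- one Euclid step (row operations on the Sylvester matrix) replaces F (k + 1) by a (ω - ω̄) (X + ω)^k;
-- expanding along the first column drops its vanishing leading coefficient at the cost of (-1)^k (a + b),
-- and every linear factor X + ω then contributes F k (-ω) = b (ω̄ - ω)^k. The resulting
-- (-1)^k (a + b) (b (ω̄ - ω)^k)^k (a (ω - ω̄))^k simplifies by a + b = 1, a b = (m² + m + 1) / 3 and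
-- (ω - ω̄)² = -3. The computation takes place in ℚ[ω], into which ℚ embeds compatibly with Defs.det.

open import Relation.Binary.PropositionalEquality
open import Algebra.Structures using (IsCommutativeRing)

module Determinants {R : Set} {add mul : R → R → R} {neg : R → R} {0r 1r : R}
  (isCommutativeRing : IsCommutativeRing _≡_ add mul neg 0r 1r) where

  open import Algebra.Bundles using (CommutativeRing)
  open import Level using (0ℓ)
  open import Function using (_∘_)
  open import Data.Nat as ℕ using (ℕ; zero; suc; s≤s; z<s; s<s; _<_; _≤_; _<?_)
  open import Data.Nat.Properties
    using (suc-injective; ≤-refl; ≤-pred; <-cmp; <-≤-trans; ≤∧≢⇒<; m≤n⇒m≤1+n; <-trans; n<1+n; <⇒≢; <⇒≤; <-irrefl)
  open import Relation.Binary.Definitions using (tri<; tri≈; tri>)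
  open import Data.Sum as Sum using (_⊎_; inj₁; inj₂)
  open import Data.Product using (_×_; _,_)
  open import Relation.Nullary using (¬_; Dec; contradiction; yes; no)

  commutativeRing : CommutativeRing 0ℓ 0ℓ
  commutativeRing = record { isCommutativeRing = isCommutativeRing }

  open CommutativeRing commutativeRing public
    using (_+_; _*_; -_; 0#; 1#; +-assoc; +-comm; +-identityˡ; +-identityʳ; *-assoc;
           *-identityˡ; *-identityʳ; distribˡ; distribʳ; zeroˡ; zeroʳ; -‿inverseˡ; -‿inverseʳ)
  open CommutativeRing commutativeRing using (ring; commutativeSemiring; +-abelianGroup; +-commutativeSemigroup)
  open import Algebra.Properties.Ring ring public using (-‿distribˡ-*; -‿distribʳ-*; -1*x≈-x)
  open import Algebra.Properties.AbelianGroup +-abelianGroup public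
    using (⁻¹-involutive; ε⁻¹≈ε; inverseʳ-unique)
  open import Algebra.Properties.CommutativeSemigroup +-commutativeSemigroup using (interchange)
  open import Algebra.Properties.CommutativeSemiring.Exp commutativeSemiring public
    using (_^_; ^-homo-*; ^-assocʳ; ^-distrib-*)
  open import Algebra.Solver.Ring.NaturalCoefficients.Default commutativeSemiring public
    using (solve; _:=_; _:+_; _:*_; con)
  open ≡-Reasoning

  sign : ℕ → R
  sign j = (- 1#) ^ j

  sign-suc : ∀ j → sign (suc j) ≡ - sign j
  sign-suc j = -1*x≈-x (sign j)

  1#^n≡1# : ∀ n → 1# ^ n ≡ 1#
  1#^n≡1# zero = refl
  1#^n≡1# (suc n) = trans (*-identityˡ _) (1#^n≡1# n)

  sum : ℕ → (ℕ → R) → R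
  sum zero f = 0#
  sum (suc n) f = f 0 + sum n (f ∘ suc)

  syntax sum n (λ j → e) = ∑[ j < n ] e

  sum-cong : ∀ n {f g : ℕ → R} → (∀ j → j < n → f j ≡ g j) → sum n f ≡ sum n g
  sum-cong zero eq = refl
  sum-cong (suc n) eq = cong₂ _+_ (eq 0 z<s) (sum-cong n (λ j j<n → eq (suc j) (s<s j<n)))

  sum-zero : ∀ n {f : ℕ → R} → (∀ j → j < n → f j ≡ 0#) → sum n f ≡ 0#
  sum-zero zero eq = refl
  sum-zero (suc n) eq =
    trans (cong₂ _+_ (eq 0 z<s) (sum-zero n (λ j j<n → eq (suc j) (s<s j<n)))) (+-identityˡ 0#)

  sum-distrib-+ : ∀ n (f g : ℕ → R) → ∑[ j < n ] (f j + g j) ≡ sum n f + sum n g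
  sum-distrib-+ zero f g = sym (+-identityˡ 0#)
  sum-distrib-+ (suc n) f g =
    trans (cong (f 0 + g 0 +_) (sum-distrib-+ n (f ∘ suc) (g ∘ suc))) (interchange _ _ _ _)

  *-distribˡ-sum : ∀ n x (f : ℕ → R) → x * sum n f ≡ ∑[ j < n ] (x * f j)
  *-distribˡ-sum zero x f = zeroʳ x
  *-distribˡ-sum (suc n) x f = trans (distribˡ x _ _) (cong (x * f 0 +_) (*-distribˡ-sum n x (f ∘ suc)))

  sum-init-last : ∀ n (f : ℕ → R) → sum (suc n) f ≡ sum n f + f n
  sum-init-last zero f = +-comm _ _
  sum-init-last (suc n) f = trans (cong (f 0 +_) (sum-init-last n (f ∘ suc))) (sym (+-assoc _ _ _))

  sum-comm : ∀ m n (f : ℕ → ℕ → R) → ∑[ i < m ] ∑[ j < n ] f i j ≡ ∑[ j < n ] ∑[ i < m ] f i j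
  sum-comm zero n f = sym (sum-zero n (λ _ _ → refl))
  sum-comm (suc m) n f =
    trans (cong (sum n (f 0) +_) (sum-comm m n (f ∘ suc))) (sym (sum-distrib-+ n (f 0) _))

  sum-single : ∀ n (f : ℕ → R) i → i < n → (∀ j → j < n → j ≢ i → f j ≡ 0#) → sum n f ≡ f i
  sum-single (suc n) f zero _ others =
    trans (cong (f 0 +_) (sum-zero n (λ j j<n → others (suc j) (s<s j<n) λ ()))) (+-identityʳ _)
  sum-single (suc n) f (suc i) (s<s i<n) others =
    trans (cong (_+ sum n (f ∘ suc)) (others 0 z<s λ ()))
      (trans (+-identityˡ _)
        (sum-single n (f ∘ suc) i i<n (λ j j<n j≢i → others (suc j) (s<s j<n) (j≢i ∘ suc-injective))))

  sum-adjacentPair : ∀ n (f : ℕ → R) i → suc i < n → (∀ j → j < n → j ≢ i → j ≢ suc i → f j ≡ 0#) →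
    sum n f ≡ f i + f (suc i)
  sum-adjacentPair (suc (suc n)) f zero _ others =
    cong (f 0 +_) (trans (cong (f 1 +_) (sum-zero n λ j j<n → others (2 ℕ.+ j) (s<s (s<s j<n)) (λ ()) (λ ())))
      (+-identityʳ _))
  sum-adjacentPair (suc n) f (suc i) (s<s i<n) others =
    trans (cong (_+ sum n (f ∘ suc)) (others 0 z<s (λ ()) (λ ())))
      (trans (+-identityˡ _)
        (sum-adjacentPair n (f ∘ suc) i i<n
          (λ j j<n j≢i j≢1+i → others (suc j) (s<s j<n) (j≢i ∘ suc-injective) (j≢1+i ∘ suc-injective))))

  sum-telescope : ∀ n (t : ℕ → R) → ∑[ j < n ] (t j + - t (suc j)) ≡ t 0 + - t n
  sum-telescope zero t = sym (-‿inverseʳ (t 0))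
  sum-telescope (suc n) t = begin
    (t 0 + - t 1) + ∑[ j < n ] (t (suc j) + - t (2 ℕ.+ j)) ≡⟨ cong (t 0 + - t 1 +_) (sum-telescope n (t ∘ suc)) ⟩
    (t 0 + - t 1) + (t 1 + - t (suc n))                  ≡⟨ +-assoc _ _ _ ⟩
    t 0 + (- t 1 + (t 1 + - t (suc n)))                  ≡⟨ cong (t 0 +_) (sym (+-assoc _ _ _)) ⟩
    t 0 + ((- t 1 + t 1) + - t (suc n))                  ≡⟨ cong (λ z → t 0 + (z + - t (suc n))) (-‿inverseˡ _) ⟩
    t 0 + (0# + - t (suc n))                             ≡⟨ cong (t 0 +_) (+-identityˡ _) ⟩
    t 0 + - t (suc n)                                    ∎

  -- Index insertion on ℕ, as Data.Fin.punchIn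

  punchIn : ℕ → ℕ → ℕ
  punchIn zero c = suc c
  punchIn (suc j) zero = zero
  punchIn (suc j) (suc c) = suc (punchIn j c)

  punchIn-< : ∀ j c n → c < n → punchIn j c < suc n
  punchIn-< zero c n c<n = s<s c<n
  punchIn-< (suc j) zero n c<n = z<s
  punchIn-< (suc j) (suc c) (suc n) (s<s c<n) = s<s (punchIn-< j c n c<n)

  punchInᵢ≢i : ∀ j c → punchIn j c ≢ j
  punchInᵢ≢i (suc j) (suc c) eq = punchInᵢ≢i j c (suc-injective eq)

  punchIn-injective : ∀ j c c' → punchIn j c ≡ punchIn j c' → c ≡ c'
  punchIn-injective zero c c' eq = suc-injective eq
  punchIn-injective (suc j) zero zero eq = refl
  punchIn-injective (suc j) (suc c) (suc c') eq = cong suc (punchIn-injective j c c' (suc-injective eq))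

  punchIn-below : ∀ j c → c < j → punchIn j c ≡ c
  punchIn-below (suc j) zero _ = refl
  punchIn-below (suc j) (suc c) (s<s c<j) = cong suc (punchIn-below j c c<j)

  punchIn-above : ∀ j c → j ≤ c → punchIn j c ≡ suc c
  punchIn-above zero c _ = refl
  punchIn-above (suc j) (suc c) (s≤s j≤c) = cong suc (punchIn-above j c j≤c)

  punchIn-adjacent : ∀ i c → punchIn i c ≡ punchIn (suc i) c ⊎ c ≡ i
  punchIn-adjacent zero zero = inj₂ refl
  punchIn-adjacent zero (suc c) = inj₁ refl
  punchIn-adjacent (suc i) zero = inj₁ refl
  punchIn-adjacent (suc i) (suc c) = Sum.map (cong suc) (cong suc) (punchIn-adjacent i c)

  punchOut : ℕ → ℕ → ℕ
  punchOut zero zero = zero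
  punchOut zero (suc x) = x
  punchOut (suc j) zero = zero
  punchOut (suc j) (suc x) = suc (punchOut j x)

  punchIn-punchOut : ∀ j x → x ≢ j → punchIn j (punchOut j x) ≡ x
  punchIn-punchOut zero zero x≢j = contradiction refl x≢j
  punchIn-punchOut zero (suc x) x≢j = refl
  punchIn-punchOut (suc j) zero x≢j = refl
  punchIn-punchOut (suc j) (suc x) x≢j = cong suc (punchIn-punchOut j x (x≢j ∘ cong suc))

  punchOut-< : ∀ j x n → x < suc n → j < suc n → x ≢ j → punchOut j x < n
  punchOut-< zero zero n _ _ x≢j = contradiction refl x≢j
  punchOut-< zero (suc x) n (s<s x<n) _ _ = x<n
  punchOut-< (suc j) zero zero _ (s<s ()) _
  punchOut-< (suc j) zero (suc n) _ _ _ = z<s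
  punchOut-< (suc j) (suc x) (suc n) (s<s x<n) (s<s j<n) x≢j =
    s<s (punchOut-< j x n x<n j<n (x≢j ∘ cong suc))

  -- Determinants of the leading n × n block of an ℕ-indexed matrix

  Matrix : Set
  Matrix = ℕ → ℕ → R

  minor : Matrix → ℕ → ℕ → Matrix
  minor M i j r c = M (punchIn i r) (punchIn j c)

  transpose : Matrix → Matrix
  transpose M r c = M c r

  det : ℕ → Matrix → R
  det zero M = 1#
  det (suc n) M = ∑[ j < suc n ] (sign j * M 0 j * det n (minor M 0 j))

  det-cong : ∀ n {M N : Matrix} → (∀ r c → r < n → c < n → M r c ≡ N r c) → det n M ≡ det n N
  det-cong zero eq = refl
  det-cong (suc n) eq = sum-cong (suc n) λ j j<n →
    cong₂ _*_ (cong (sign j *_) (eq 0 j z<s j<n))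
      (det-cong n λ r c r<n c<n → eq (suc r) (punchIn j c) (s<s r<n) (punchIn-< j c n c<n))

  det-expandFirstColumn : ∀ n M → det (suc n) M ≡ ∑[ i < suc n ] (sign i * M i 0 * det n (minor M i 0))
  det-expandFirstColumn zero M = refl
  det-expandFirstColumn (suc n) M = cong (sign 0 * M 0 0 * det (suc n) (minor M 0 0) +_) (begin
    ∑[ j < suc n ] (sign (suc j) * M 0 (suc j) * det (suc n) (minor M 0 (suc j)))
      ≡⟨ sum-cong (suc n) (λ j _ →
           trans (cong (sign (suc j) * M 0 (suc j) *_) (det-expandFirstColumn n (minor M 0 (suc j))))
             (*-distribˡ-sum (suc n) (sign (suc j) * M 0 (suc j)) λ i → sign i * M (suc i) 0 * D i j)) ⟩
    ∑[ j < suc n ] ∑[ i < suc n ] (sign (suc j) * M 0 (suc j) * (sign i * M (suc i) 0 * D i j))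
      ≡⟨ sum-comm (suc n) (suc n) (λ j i → sign (suc j) * M 0 (suc j) * (sign i * M (suc i) 0 * D i j)) ⟩
    ∑[ i < suc n ] ∑[ j < suc n ] (sign (suc j) * M 0 (suc j) * (sign i * M (suc i) 0 * D i j))
      ≡⟨ sum-cong (suc n) (λ i _ →
           trans (sum-cong (suc n) (λ j _ → swapFactors (- 1#) (sign j) (sign i) (M 0 (suc j)) (M (suc i) 0) (D i j)))
             (sym (*-distribˡ-sum (suc n) (sign (suc i) * M (suc i) 0) λ j → sign j * M 0 (suc j) * D i j))) ⟩
    ∑[ i < suc n ] (sign (suc i) * M (suc i) 0 * det (suc n) (minor M (suc i) 0)) ∎)
    where
    D : ℕ → ℕ → R
    D i j = det n (λ a b → M (suc (punchIn i a)) (suc (punchIn j b)))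
    swapFactors : ∀ m sj si a b d → m * sj * a * (si * b * d) ≡ m * si * b * (sj * a * d)
    swapFactors = solve 6 (λ m sj si a b d → m :* sj :* a :* (si :* b :* d) := m :* si :* b :* (sj :* a :* d)) refl

  det-transpose : ∀ n M → det n (transpose M) ≡ det n M
  det-transpose zero M = refl
  det-transpose (suc n) M =
    trans (sum-cong (suc n) λ j _ → cong (sign j * M j 0 *_) (det-transpose n (minor M j 0)))
      (sym (det-expandFirstColumn n M))

  det-linearInColumn : ∀ n c → c < n → (M P Q : Matrix) (x y : R) →
    (∀ r d → d ≢ c → M r d ≡ P r d) → (∀ r d → d ≢ c → M r d ≡ Q r d) →
    (∀ r → M r c ≡ x * P r c + y * Q r c) → det n M ≡ x * det n P + y * det n Q
  det-linearInColumn (suc n) c c<n M P Q x y M≡P M≡Q M≡xP+yQ = begin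
    det (suc n) M                                       ≡⟨ sum-cong (suc n) term ⟩
    ∑[ j < suc n ] (x * termP j + y * termQ j)          ≡⟨ sum-distrib-+ (suc n) (λ j → x * termP j) (λ j → y * termQ j) ⟩
    ∑[ j < suc n ] (x * termP j) + ∑[ j < suc n ] (y * termQ j)
      ≡⟨ sym (cong₂ _+_ (*-distribˡ-sum (suc n) x termP) (*-distribˡ-sum (suc n) y termQ)) ⟩
    x * det (suc n) P + y * det (suc n) Q               ∎
    where
    termP termQ : ℕ → R
    termP j = sign j * P 0 j * det n (minor P 0 j)
    termQ j = sign j * Q 0 j * det n (minor Q 0 j)
    pullOut : ∀ s x y p q d → s * (x * p + y * q) * d ≡ x * (s * p * d) + y * (s * q * d)
    pullOut = solve 6 (λ s x y p q d → s :* (x :* p :+ y :* q) :* d := (x :* (s :* p :* d) :+ y :* (s :* q :* d))) refl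
    pushIn : ∀ s v x y a b → s * v * (x * a + y * b) ≡ x * (s * v * a) + y * (s * v * b)
    pushIn = solve 6 (λ s v x y a b → s :* v :* (x :* a :+ y :* b) := (x :* (s :* v :* a) :+ y :* (s :* v :* b))) refl
    term : ∀ j → j < suc n → sign j * M 0 j * det n (minor M 0 j) ≡ x * termP j + y * termQ j
    term j j<n with j ℕ.≟ c
    ... | yes refl = begin
      sign j * M 0 j * det n (minor M 0 j)
        ≡⟨ cong₂ (λ u v → sign j * u * v) (M≡xP+yQ 0)
             (det-cong n λ r d _ _ → M≡P (suc r) (punchIn j d) (punchInᵢ≢i j d)) ⟩
      sign j * (x * P 0 j + y * Q 0 j) * det n (minor P 0 j)  ≡⟨ pullOut (sign j) x y (P 0 j) (Q 0 j) _ ⟩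
      x * termP j + y * (sign j * Q 0 j * det n (minor P 0 j))
        ≡⟨ cong (λ z → x * termP j + y * (sign j * Q 0 j * z)) (det-cong n λ r d _ _ →
             trans (sym (M≡P (suc r) (punchIn j d) (punchInᵢ≢i j d))) (M≡Q (suc r) (punchIn j d) (punchInᵢ≢i j d))) ⟩
      x * termP j + y * termQ j                                 ∎
    ... | no j≢c = begin
      sign j * M 0 j * det n (minor M 0 j)
        ≡⟨ cong (sign j * M 0 j *_) (det-linearInColumn n c' c'<n _ _ _ x y
             (λ r d d≢c' → M≡P (suc r) (punchIn j d) (d≢c' ∘ punchIn-injective j d c' ∘ (λ e → trans e (sym c≡))))
             (λ r d d≢c' → M≡Q (suc r) (punchIn j d) (d≢c' ∘ punchIn-injective j d c' ∘ (λ e → trans e (sym c≡))))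
             (λ r → trans (cong (M (suc r)) c≡)
               (trans (M≡xP+yQ (suc r)) (cong₂ (λ u v → x * P (suc r) u + y * Q (suc r) v) (sym c≡) (sym c≡))))) ⟩
      sign j * M 0 j * (x * det n (minor P 0 j) + y * det n (minor Q 0 j))
        ≡⟨ pushIn (sign j) (M 0 j) x y _ _ ⟩
      x * (sign j * M 0 j * det n (minor P 0 j)) + y * (sign j * M 0 j * det n (minor Q 0 j))
        ≡⟨ cong₂ (λ u v → x * (sign j * u * _) + y * (sign j * v * _)) (M≡P 0 j j≢c) (M≡Q 0 j j≢c) ⟩
      x * termP j + y * termQ j                                                     ∎
      where
      c' = punchOut j c
      c≡ : punchIn j c' ≡ c
      c≡ = punchIn-punchOut j c (j≢c ∘ sym)
      c'<n : c' < n
      c'<n = punchOut-< j c n c<n j<n (j≢c ∘ sym)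

  det-adjacentEqualColumns : ∀ n a → suc a < n → (M : Matrix) → (∀ r → M r a ≡ M r (suc a)) → det n M ≡ 0#
  det-adjacentEqualColumns (suc n) a 1+a<n M equal = begin
    det (suc n) M                                          ≡⟨ sum-adjacentPair (suc n) _ a 1+a<n otherTerms ⟩
    sign a * M 0 a * D a + sign (suc a) * M 0 (suc a) * D (suc a)
      ≡⟨ cong₂ (λ u v → sign a * M 0 a * D a + u * v * D (suc a)) (sign-suc a) (sym (equal 0)) ⟩
    sign a * M 0 a * D a + - sign a * M 0 a * D (suc a)
      ≡⟨ cong (λ z → sign a * M 0 a * D a + - sign a * M 0 a * z) sameMinor ⟨
    sign a * M 0 a * D a + - sign a * M 0 a * D a
      ≡⟨ cong (sign a * M 0 a * D a +_) (trans (cong (_* D a) (sym (-‿distribˡ-* _ _))) (sym (-‿distribˡ-* _ _))) ⟩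
    sign a * M 0 a * D a + - (sign a * M 0 a * D a)       ≡⟨ -‿inverseʳ _ ⟩
    0#                                                     ∎
    where
    D : ℕ → R
    D j = det n (minor M 0 j)
    sameMinor : D a ≡ D (suc a)
    sameMinor = det-cong n λ r c _ _ → sameEntry r c (punchIn-adjacent a c)
      where
      sameEntry : ∀ r c → punchIn a c ≡ punchIn (suc a) c ⊎ c ≡ a →
        M (suc r) (punchIn a c) ≡ M (suc r) (punchIn (suc a) c)
      sameEntry r c (inj₁ eq) = cong (M (suc r)) eq
      sameEntry r .a (inj₂ refl) = trans (cong (M (suc r)) (punchIn-above a a ≤-refl))
        (trans (sym (equal (suc r))) (cong (M (suc r)) (sym (punchIn-below (suc a) a ≤-refl))))
    otherTerms : ∀ j → j < suc n → j ≢ a → j ≢ suc a → sign j * M 0 j * D j ≡ 0#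
    otherTerms j j<n j≢a j≢1+a = trans (cong (sign j * M 0 j *_) minorVanishes) (zeroʳ _)
      where
      minorVanishes : D j ≡ 0#
      minorVanishes with <-cmp j a
      ... | tri≈ _ j≡a _ = contradiction j≡a j≢a
      ... | tri< j<a _ _ = belowCase a equal 1+a<n j<a
        where
        belowCase : ∀ a → (∀ r → M r a ≡ M r (suc a)) → suc a < suc n → j < a → D j ≡ 0#
        belowCase (suc a) equal 2+a<n (s≤s j≤a) = det-adjacentEqualColumns n a (≤-pred 2+a<n) (minor M 0 j) λ r →
          trans (cong (M (suc r)) (punchIn-above j a j≤a))
            (trans (equal (suc r)) (cong (M (suc r)) (sym (punchIn-above j (suc a) (m≤n⇒m≤1+n j≤a)))))
      ... | tri> _ _ a<j = det-adjacentEqualColumns n a (<-≤-trans 1+a<j (≤-pred j<n)) (minor M 0 j) λ r →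
        trans (cong (M (suc r)) (punchIn-below j a a<j))
          (trans (equal (suc r)) (cong (M (suc r)) (sym (punchIn-below j (suc a) 1+a<j))))
        where
        1+a<j : suc a < j
        1+a<j = ≤∧≢⇒< a<j (j≢1+a ∘ sym)

  det-additiveInColumn : ∀ n c → c < n → (M P Q : Matrix) →
    (∀ r d → d ≢ c → M r d ≡ P r d) → (∀ r d → d ≢ c → M r d ≡ Q r d) →
    (∀ r → M r c ≡ P r c + Q r c) → det n M ≡ det n P + det n Q
  det-additiveInColumn n c c<n M P Q M≡P M≡Q M≡P+Q =
    trans (det-linearInColumn n c c<n M P Q 1# 1# M≡P M≡Q
            (λ r → trans (M≡P+Q r) (sym (cong₂ _+_ (*-identityˡ _) (*-identityˡ _)))))
      (cong₂ _+_ (*-identityˡ _) (*-identityˡ _))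

  column : Matrix → ℕ → ℕ → R
  column M c r = M r c

  setColumn : ℕ → (ℕ → R) → Matrix → Matrix
  setColumn c v M r d with d ℕ.≟ c
  ... | yes _ = v r
  ... | no _ = M r d

  setColumn-≡ : ∀ c v M r → setColumn c v M r c ≡ v r
  setColumn-≡ c v M r with c ℕ.≟ c
  ... | yes _ = refl
  ... | no c≢c = contradiction refl c≢c

  setColumn-≢ : ∀ c v M r d → d ≢ c → setColumn c v M r d ≡ M r d
  setColumn-≢ c v M r d d≢c with d ℕ.≟ c
  ... | yes d≡c = contradiction d≡c d≢c
  ... | no _ = refl

  setAdjacentColumns : ℕ → (ℕ → R) → (ℕ → R) → Matrix → Matrix
  setAdjacentColumns a f g M = setColumn (suc a) g (setColumn a f M)

  swapAdjacentColumns : ℕ → Matrix → Matrix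
  swapAdjacentColumns a M = setAdjacentColumns a (column M (suc a)) (column M a) M

  module _ (a : ℕ) (M : Matrix) where

    setAdjacentColumns-fst : ∀ f g r → setAdjacentColumns a f g M r a ≡ f r
    setAdjacentColumns-fst f g r = trans (setColumn-≢ (suc a) g _ r a (<⇒≢ (n<1+n a))) (setColumn-≡ a f M r)

    setAdjacentColumns-snd : ∀ f g r → setAdjacentColumns a f g M r (suc a) ≡ g r
    setAdjacentColumns-snd f g r = setColumn-≡ (suc a) g _ r

    setAdjacentColumns-other : ∀ f g r d → d ≢ a → d ≢ suc a → setAdjacentColumns a f g M r d ≡ M r d
    setAdjacentColumns-other f g r d d≢a d≢1+a = trans (setColumn-≢ (suc a) g _ r d d≢1+a) (setColumn-≢ a f M r d d≢a)

    setAdjacentColumns-≢fst : ∀ f f' g r d → d ≢ a → setAdjacentColumns a f g M r d ≡ setAdjacentColumns a f' g M r d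
    setAdjacentColumns-≢fst f f' g r d d≢a = byCases (d ℕ.≟ suc a)
      where
      byCases : Dec (d ≡ suc a) → setAdjacentColumns a f g M r d ≡ setAdjacentColumns a f' g M r d
      byCases (yes refl) = trans (setAdjacentColumns-snd f g r) (sym (setAdjacentColumns-snd f' g r))
      byCases (no d≢1+a) =
        trans (setAdjacentColumns-other f g r d d≢a d≢1+a) (sym (setAdjacentColumns-other f' g r d d≢a d≢1+a))

    setAdjacentColumns-≢snd : ∀ f g g' r d → d ≢ suc a → setAdjacentColumns a f g M r d ≡ setAdjacentColumns a f g' M r d
    setAdjacentColumns-≢snd f g g' r d d≢1+a =
      trans (setColumn-≢ (suc a) g _ r d d≢1+a) (sym (setColumn-≢ (suc a) g' _ r d d≢1+a))

    setAdjacentColumns-id : ∀ r d → setAdjacentColumns a (column M a) (column M (suc a)) M r d ≡ M r d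
    setAdjacentColumns-id r d = byCases (d ℕ.≟ a) (d ℕ.≟ suc a)
      where
      byCases : Dec (d ≡ a) → Dec (d ≡ suc a) → setAdjacentColumns a (column M a) (column M (suc a)) M r d ≡ M r d
      byCases (yes refl) _ = setAdjacentColumns-fst _ _ r
      byCases (no _) (yes refl) = setAdjacentColumns-snd _ _ r
      byCases (no d≢a) (no d≢1+a) = setAdjacentColumns-other _ _ r d d≢a d≢1+a

  -- Expand det with both columns a, a + 1 replaced by the sum u of the two; the outer terms vanish.
  det-swapAdjacentColumns : ∀ n a → suc a < n → (M : Matrix) → det n (swapAdjacentColumns a M) ≡ - det n M
  det-swapAdjacentColumns n a 1+a<n M = inverseʳ-unique (det n M) (det n (setPair w v)) (begin
    det n M + det n (setPair w v)                                             ≡⟨ cong₂ _+_ left right ⟨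
    (det n (setPair v v) + det n (setPair v w)) + (det n (setPair w v) + det n (setPair w w))
      ≡⟨ cong₂ _+_ (additiveSnd v v w) (additiveSnd w v w) ⟨
    det n (setPair v u) + det n (setPair w u)                                 ≡⟨ additiveFst v w u ⟨
    det n (setPair u u)                                                       ≡⟨ equalPair u ⟩
    0#                                                                        ∎)
    where
    a<n = <-trans (n<1+n a) 1+a<n
    setPair : (ℕ → R) → (ℕ → R) → Matrix
    setPair f g = setAdjacentColumns a f g M
    v w u : ℕ → R
    v = column M a
    w = column M (suc a)
    u r = v r + w r
    additiveFst : ∀ f f' g → det n (setPair (λ r → f r + f' r) g) ≡ det n (setPair f g) + det n (setPair f' g)
    additiveFst f f' g = det-additiveInColumn n a a<n _ _ _
      (setAdjacentColumns-≢fst a M _ _ g) (setAdjacentColumns-≢fst a M _ _ g)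
      (λ r → trans (setAdjacentColumns-fst a M _ g r)
        (sym (cong₂ _+_ (setAdjacentColumns-fst a M f g r) (setAdjacentColumns-fst a M f' g r))))
    additiveSnd : ∀ f g g' → det n (setPair f (λ r → g r + g' r)) ≡ det n (setPair f g) + det n (setPair f g')
    additiveSnd f g g' = det-additiveInColumn n (suc a) 1+a<n _ _ _
      (setAdjacentColumns-≢snd a M f _ _) (setAdjacentColumns-≢snd a M f _ _)
      (λ r → trans (setAdjacentColumns-snd a M f _ r)
        (sym (cong₂ _+_ (setAdjacentColumns-snd a M f g r) (setAdjacentColumns-snd a M f g' r))))
    equalPair : ∀ f → det n (setPair f f) ≡ 0#
    equalPair f = det-adjacentEqualColumns n a 1+a<n _ λ r →
      trans (setAdjacentColumns-fst a M f f r) (sym (setAdjacentColumns-snd a M f f r))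
    left : det n (setPair v v) + det n (setPair v w) ≡ det n M
    left = trans (cong (_+ det n (setPair v w)) (equalPair v))
      (trans (+-identityˡ _) (det-cong n λ r d _ _ → setAdjacentColumns-id a M r d))
    right : det n (setPair w v) + det n (setPair w w) ≡ det n (setPair w v)
    right = trans (cong (det n (setPair w v) +_) (equalPair w)) (+-identityʳ _)

  det-equalColumns-< : ∀ n a b (M : Matrix) → a < b → b < n → (∀ r → M r a ≡ M r b) → det n M ≡ 0#
  det-equalColumns-< n a (suc b) M (s≤s a≤b) 1+b<n equal with a ℕ.≟ b
  ... | yes refl = det-adjacentEqualColumns n a 1+b<n M equal
  ... | no a≢b = begin
    det n M                            ≡⟨ sym (⁻¹-involutive _) ⟩
    - - det n M                        ≡⟨ cong -_ (sym (det-swapAdjacentColumns n b 1+b<n M)) ⟩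
    - det n (swapAdjacentColumns b M)  ≡⟨ cong -_ (det-equalColumns-< n a b _ a<b (<-trans (n<1+n b) 1+b<n) λ r →
                                            trans (setAdjacentColumns-other b M _ _ r a a≢b (<⇒≢ (<-trans a<b (n<1+n b))))
                                              (trans (equal r) (sym (setAdjacentColumns-fst b M _ _ r)))) ⟩
    - 0#                               ≡⟨ ε⁻¹≈ε ⟩
    0#                                 ∎
    where
    a<b = ≤∧≢⇒< a≤b a≢b

  det-equalColumns : ∀ n a b (M : Matrix) → a < n → b < n → a ≢ b → (∀ r → M r a ≡ M r b) → det n M ≡ 0#
  det-equalColumns n a b M a<n b<n a≢b equal with <-cmp a b
  ... | tri< a<b _ _ = det-equalColumns-< n a b M a<b b<n equal
  ... | tri≈ _ a≡b _ = contradiction a≡b a≢b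
  ... | tri> _ _ b<a = det-equalColumns-< n b a M b<a a<n (sym ∘ equal)

  det-addColumnMultiple : ∀ n c c' (M M' : Matrix) x → c < n → c' < n → c' ≢ c →
    (∀ r d → d ≢ c → M' r d ≡ M r d) → (∀ r → M' r c ≡ M r c + x * M r c') → det n M' ≡ det n M
  det-addColumnMultiple n c c' M M' x c<n c'<n c'≢c off M'≡M+xM = begin
    det n M'                     ≡⟨ det-linearInColumn n c c<n M' M copied 1# x off
                                      (λ r d d≢c → trans (off r d d≢c) (sym (setColumn-≢ c _ M r d d≢c)))
                                      (λ r → trans (M'≡M+xM r)
                                         (cong₂ _+_ (sym (*-identityˡ _)) (cong (x *_) (sym (setColumn-≡ c _ M r))))) ⟩
    1# * det n M + x * det n copied ≡⟨ cong₂ _+_ (*-identityˡ _) (trans (cong (x *_) copiedVanishes) (zeroʳ x)) ⟩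
    det n M + 0#                 ≡⟨ +-identityʳ _ ⟩
    det n M                      ∎
    where
    copied = setColumn c (column M c') M
    copiedVanishes : det n copied ≡ 0#
    copiedVanishes = det-equalColumns n c c' copied c<n c'<n (c'≢c ∘ sym)
      (λ r → trans (setColumn-≡ c _ M r) (sym (setColumn-≢ c _ M r c' c'≢c)))

  Admissible : ℕ → ℕ → R → ℕ → Set
  Admissible n c x ρ = x ≡ 0# ⊎ (ρ < n × ρ ≢ c)

  det-addAdmissibleMultiple : ∀ n c ρ x (M M' : Matrix) → c < n → Admissible n c x ρ →
    (∀ r d → d ≢ c → M' r d ≡ M r d) → (∀ r → M' r c ≡ M r c + x * M r ρ) → det n M' ≡ det n M
  det-addAdmissibleMultiple n c ρ x M M' c<n (inj₂ (ρ<n , ρ≢c)) = det-addColumnMultiple n c ρ M M' x c<n ρ<n ρ≢c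
  det-addAdmissibleMultiple n c ρ _ M M' c<n (inj₁ refl) off M'≡M+0 = det-cong n λ r d _ _ → entry r d (d ℕ.≟ c)
    where
    entry : ∀ r d → Dec (d ≡ c) → M' r d ≡ M r d
    entry r d (yes refl) = trans (M'≡M+0 r) (trans (cong (M r d +_) (zeroˡ _)) (+-identityʳ _))
    entry r d (no d≢c) = off r d d≢c

  updateColumnsBelow : ℕ → Matrix → Matrix → Matrix
  updateColumnsBelow t M' M r d with d <? t
  ... | yes _ = M' r d
  ... | no _ = M r d

  updateColumnsBelow-below : ∀ t M' M r d → d < t → updateColumnsBelow t M' M r d ≡ M' r d
  updateColumnsBelow-below t M' M r d d<t with d <? t
  ... | yes _ = refl
  ... | no d≮t = contradiction d<t d≮t

  updateColumnsBelow-above : ∀ t M' M r d → ¬ d < t → updateColumnsBelow t M' M r d ≡ M r d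
  updateColumnsBelow-above t M' M r d d≮t with d <? t
  ... | yes d<t = contradiction d<t d≮t
  ... | no _ = refl

  updateColumnsBelow-step : ∀ t M' M r d → d ≢ t → updateColumnsBelow (suc t) M' M r d ≡ updateColumnsBelow t M' M r d
  updateColumnsBelow-step t M' M r d d≢t with d <? suc t | d <? t
  ... | yes _ | yes _ = refl
  ... | no _ | no _ = refl
  ... | yes d<1+t | no d≮t = contradiction (≤∧≢⇒< (≤-pred d<1+t) d≢t) d≮t
  ... | no d≮1+t | yes d<t = contradiction (<-trans d<t (n<1+n t)) d≮1+t

  -- The column operations are applied from left to right: column c may use the updated columns before it.
  det-columnSweep : ∀ n (M M' : Matrix) (ρ σ : ℕ → ℕ) (x y : ℕ → R) →
    (∀ c → c < n → Admissible n c (x c) (ρ c)) → (∀ c → c < n → Admissible n c (y c) (σ c)) →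
    (∀ r c → c < n → M' r c ≡ M r c + x c * updateColumnsBelow c M' M r (ρ c)
                                    + y c * updateColumnsBelow c M' M r (σ c)) →
    det n M' ≡ det n M
  det-columnSweep n M M' ρ σ x y admissibleρ admissibleσ sweep =
    trans (det-cong n λ r d _ d<n → sym (updateColumnsBelow-below n M' M r d d<n)) (fromStage n ≤-refl)
    where
    stage : ℕ → Matrix
    stage t = updateColumnsBelow t M' M
    step : ∀ t → t < n → det n (stage (suc t)) ≡ det n (stage t)
    step t t<n =
      trans (det-addAdmissibleMultiple n t (σ t) (y t) halfway (stage (suc t)) t<n (admissibleσ t t<n) offσ columnσ)
        (det-addAdmissibleMultiple n t (ρ t) (x t) (stage t) halfway t<n (admissibleρ t t<n)
          (λ r d → setColumn-≢ t _ _ r d) (λ r → setColumn-≡ t _ _ r))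
      where
      halfway : Matrix
      halfway = setColumn t (λ r → stage t r t + x t * stage t r (ρ t)) (stage t)
      offσ : ∀ r d → d ≢ t → stage (suc t) r d ≡ halfway r d
      offσ r d d≢t = trans (updateColumnsBelow-step t M' M r d d≢t) (sym (setColumn-≢ t _ _ r d d≢t))
      σTerm : ∀ r → y t * stage t r (σ t) ≡ y t * halfway r (σ t)
      σTerm r with admissibleσ t t<n
      ... | inj₁ y≡0 = trans (cong (_* _) y≡0) (trans (zeroˡ _) (sym (trans (cong (_* _) y≡0) (zeroˡ _))))
      ... | inj₂ (_ , σ≢t) = cong (y t *_) (sym (setColumn-≢ t _ _ r (σ t) σ≢t))
      columnσ : ∀ r → stage (suc t) r t ≡ halfway r t + y t * halfway r (σ t)
      columnσ r = trans (updateColumnsBelow-below (suc t) M' M r t (n<1+n t)) (trans (sweep r t t<n)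
        (cong₂ _+_
          (sym (trans (setColumn-≡ t _ _ r) (cong (_+ x t * stage t r (ρ t))
            (updateColumnsBelow-above t M' M r t (<-irrefl refl)))))
          (σTerm r)))
    fromStage : ∀ t → t ≤ n → det n (stage t) ≡ det n M
    fromStage zero _ = det-cong n λ r d _ _ → updateColumnsBelow-above 0 M' M r d λ ()
    fromStage (suc t) t<n = trans (step t t<n) (fromStage t (<⇒≤ t<n))

  updateRowsBelow : ℕ → Matrix → Matrix → Matrix
  updateRowsBelow t M' M = transpose (updateColumnsBelow t (transpose M') (transpose M))

  det-rowSweep : ∀ n (M M' : Matrix) (ρ σ : ℕ → ℕ) (x y : ℕ → R) →
    (∀ r → r < n → Admissible n r (x r) (ρ r)) → (∀ r → r < n → Admissible n r (y r) (σ r)) →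
    (∀ r c → r < n → M' r c ≡ M r c + x r * updateRowsBelow r M' M (ρ r) c
                                    + y r * updateRowsBelow r M' M (σ r) c) →
    det n M' ≡ det n M
  det-rowSweep n M M' ρ σ x y admissibleρ admissibleσ sweep = begin
    det n M'                ≡⟨ sym (det-transpose n M') ⟩
    det n (transpose M')    ≡⟨ det-columnSweep n (transpose M) (transpose M') ρ σ x y admissibleρ admissibleσ
                                 (λ c r r<n → sweep r c r<n) ⟩
    det n (transpose M)     ≡⟨ det-transpose n M ⟩
    det n M                 ∎

  det-firstColumnSingle : ∀ n (M : Matrix) i → i < suc n → (∀ r → r < suc n → r ≢ i → M r 0 ≡ 0#) →
    det (suc n) M ≡ sign i * M i 0 * det n (minor M i 0)
  det-firstColumnSingle n M i i<n single = trans (det-expandFirstColumn n M) (sum-single (suc n) _ i i<n λ r r<n r≢i →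
    trans (cong (λ z → sign r * z * det n (minor M r 0)) (single r r<n r≢i))
      (trans (cong (_* det n (minor M r 0)) (zeroʳ (sign r))) (zeroˡ _)))

  det-lastColumnAboveZero : ∀ n (M : Matrix) → (∀ r → r < n → M r n ≡ 0#) → det (suc n) M ≡ M n n * det n M
  det-lastColumnAboveZero zero M _ = trans (+-identityʳ _) (cong (_* 1#) (*-identityˡ _))
  det-lastColumnAboveZero (suc n) M aboveZero = begin
    det (suc (suc n)) M                               ≡⟨ sum-init-last (suc n) term ⟩
    sum (suc n) term + term (suc n)                   ≡⟨ cong₂ _+_ (sum-cong (suc n) expandMinor) lastTerm ⟩
    ∑[ j < suc n ] (corner * (sign j * M 0 j * D j)) + 0#  ≡⟨ +-identityʳ _ ⟩
    ∑[ j < suc n ] (corner * (sign j * M 0 j * D j))  ≡⟨ sym (*-distribˡ-sum (suc n) corner λ j → sign j * M 0 j * D j) ⟩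
    corner * det (suc n) M                            ∎
    where
    corner = M (suc n) (suc n)
    term : ℕ → R
    term j = sign j * M 0 j * det (suc n) (minor M 0 j)
    D : ℕ → R
    D j = det n (minor M 0 j)
    lastTerm : term (suc n) ≡ 0#
    lastTerm = trans (cong (λ z → sign (suc n) * z * det (suc n) (minor M 0 (suc n))) (aboveZero 0 z<s))
      (trans (cong (_* det (suc n) (minor M 0 (suc n))) (zeroʳ _)) (zeroˡ _))
    rotate : ∀ s m c d → s * m * (c * d) ≡ c * (s * m * d)
    rotate = solve 4 (λ s m c d → s :* m :* (c :* d) := c :* (s :* m :* d)) refl
    expandMinor : ∀ j → j < suc n → term j ≡ corner * (sign j * M 0 j * D j)
    expandMinor j (s≤s j≤n) = begin
      sign j * M 0 j * det (suc n) (minor M 0 j)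
        ≡⟨ cong (sign j * M 0 j *_) (det-lastColumnAboveZero n _ λ r r<n →
             trans (cong (M (suc r)) (punchIn-above j n j≤n)) (aboveZero (suc r) (s<s r<n))) ⟩
      sign j * M 0 j * (M (suc n) (punchIn j n) * D j)
        ≡⟨ cong (λ z → sign j * M 0 j * (M (suc n) z * D j)) (punchIn-above j n j≤n) ⟩
      sign j * M 0 j * (corner * D j)                    ≡⟨ rotate (sign j) (M 0 j) corner (D j) ⟩
      corner * (sign j * M 0 j * D j)                    ∎

  det-diagonal : ∀ n (M : Matrix) x → (∀ r → r < n → M r r ≡ x) → (∀ r c → r < n → c < n → r ≢ c → M r c ≡ 0#) →
    det n M ≡ x ^ n
  det-diagonal zero M x _ _ = refl
  det-diagonal (suc n) M x diagonal offDiagonal = begin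
    det (suc n) M
      ≡⟨ sum-single (suc n) _ 0 z<s (λ j j<n j≢0 →
           trans (cong (λ z → sign j * z * det n (minor M 0 j)) (offDiagonal 0 j z<s j<n (j≢0 ∘ sym)))
             (trans (cong (_* det n (minor M 0 j)) (zeroʳ _)) (zeroˡ _))) ⟩
    1# * M 0 0 * det n (minor M 0 0)
      ≡⟨ cong₂ (λ u v → 1# * u * v) (diagonal 0 z<s)
           (det-diagonal n _ x (λ r r<n → diagonal (suc r) (s<s r<n))
             (λ r c r<n c<n r≢c → offDiagonal (suc r) (suc c) (s<s r<n) (s<s c<n) (r≢c ∘ suc-injective))) ⟩
    1# * x * x ^ n
      ≡⟨ cong (_* x ^ n) (*-identityˡ x) ⟩
    x ^ suc n ∎

module SylvesterResultants {R : Set} {add mul : R → R → R} {neg : R → R} {0r 1r : R}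
  (isCommutativeRing : IsCommutativeRing _≡_ add mul neg 0r 1r) where

  open import Function using (_∘_)
  open import Data.Nat as ℕ using (ℕ; zero; suc; z≤n; s≤s; z<s; s<s; _<_; _≤_; _<?_)
  open import Data.Nat.Properties
    using (≤-trans; <-cmp; <-≤-trans; ≤∧≢⇒<; <-trans; n<1+n; <⇒≢; <⇒≤;
           <-irrefl; <-asym; ≤⇒≯; ≮⇒≥; m≤m+n; m≤n+m; m<n+m; +-monoʳ-≤; +-monoʳ-<; +-cancelˡ-<; m+[n∸m]≡n)
  open import Data.Integer as ℤ using (ℤ; +_; -[1+_]; _⊖_)
  open import Data.Integer.Properties using ([1+m]⊖[1+n]≡m⊖n; ⊖-≥; n⊖n≡0; distribʳ-⊖-+-neg)
  import Data.Integer.Properties as ℤₚ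
  import Data.Nat.Properties as ℕₚ
  import Data.Integer.Tactic.RingSolver as ℤ-Solver
  open import Data.Product using (_,_; ∃-syntax)
  open import Data.Sum using (inj₁; inj₂; [_,_]′)
  open import Relation.Binary.Definitions using (tri<; tri≈; tri>)
  open import Relation.Nullary using (¬_; contradiction)
  open import Relation.Nullary.Decidable using (yes; no; toSum)

  open Determinants isCommutativeRing public
  open ≡-Reasoning

  -- A polynomial is given by its coefficients, indexed by ℤ so that shifts need no case analysis.
  Poly : Set
  Poly = ℤ → R

  NoNegativePowers : Poly → Set
  NoNegativePowers P = ∀ i → P -[1+ i ] ≡ 0#

  Degree≤ : Poly → ℕ → Set
  Degree≤ P d = ∀ i → d < i → P (+ i) ≡ 0#

  m<n⇒m⊖n≡-[1+_] : ∀ m n → m < n → ∃[ j ] (m ⊖ n ≡ -[1+ j ])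
  m<n⇒m⊖n≡-[1+_] zero (suc n) _ = n , refl
  m<n⇒m⊖n≡-[1+_] (suc m) (suc n) (s<s m<n) with m<n⇒m⊖n≡-[1+_] m n m<n
  ... | j , eq = j , trans ([1+m]⊖[1+n]≡m⊖n m n) eq

  pred-⊖ : ∀ m n → ℤ.pred (m ⊖ n) ≡ m ⊖ suc n
  pred-⊖ m n = distribʳ-⊖-+-neg 0 m n

  pred-[1+m]⊖n : ∀ m n → ℤ.pred (suc m ⊖ n) ≡ m ⊖ n
  pred-[1+m]⊖n m n = trans (pred-⊖ (suc m) n) ([1+m]⊖[1+n]≡m⊖n m n)

  m⊖0≡+m : ∀ m → m ⊖ 0 ≡ + m
  m⊖0≡+m m = ⊖-≥ z≤n

  noNegativePowers-⊖ : ∀ P → NoNegativePowers P → ∀ m n → m < n → P (m ⊖ n) ≡ 0#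
  noNegativePowers-⊖ P noNegative m n m<n with m<n⇒m⊖n≡-[1+_] m n m<n
  ... | j , eq = trans (cong P eq) (noNegative j)

  degree≤-⊖ : ∀ P d → Degree≤ P d → ∀ m n → n ℕ.+ d < m → P (m ⊖ n) ≡ 0#
  degree≤-⊖ P d degree m n n+d<m = trans (cong P (⊖-≥ n≤m)) (degree (m ℕ.∸ n) d<m∸n)
    where
    n≤m : n ≤ m
    n≤m = ≤-trans (m≤m+n n d) (<⇒≤ n+d<m)
    d<m∸n : d < m ℕ.∸ n
    d<m∸n = +-cancelˡ-< n d (m ℕ.∸ n) (subst (n ℕ.+ d <_) (sym (m+[n∸m]≡n n≤m)) n+d<m)

  -- Rows r < l hold the coefficients of A (leading one first) shifted right by r;
  -- the remaining rows hold those of B, shifted right by r - l.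
  sylvesterMatrix : ℕ → ℕ → Poly → Poly → Matrix
  sylvesterMatrix k l A B r c with r <? l
  ... | yes _ = A ((k ℕ.+ r) ⊖ c)
  ... | no _ = B (r ⊖ c)

  resultant : ℕ → ℕ → Poly → Poly → R
  resultant k l A B = det (k ℕ.+ l) (sylvesterMatrix k l A B)

  sylvesterMatrix-upper : ∀ k l A B r c → r < l → sylvesterMatrix k l A B r c ≡ A ((k ℕ.+ r) ⊖ c)
  sylvesterMatrix-upper k l A B r c r<l with r <? l
  ... | yes _ = refl
  ... | no r≮l = contradiction r<l r≮l

  sylvesterMatrix-lower : ∀ k l A B r c → ¬ r < l → sylvesterMatrix k l A B r c ≡ B (r ⊖ c)
  sylvesterMatrix-lower k l A B r c r≮l with r <? l
  ... | yes r<l = contradiction r<l r≮l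
  ... | no _ = refl

  sylvesterMatrix-cong : ∀ k l {A A' B B'} → (∀ z → A z ≡ A' z) → (∀ z → B z ≡ B' z) →
    ∀ r c → sylvesterMatrix k l A B r c ≡ sylvesterMatrix k l A' B' r c
  sylvesterMatrix-cong k l {A} {A'} {B} {B'} A≗A' B≗B' r c = [ upper , lower ]′ (toSum (r <? l))
    where
    upper : r < l → sylvesterMatrix k l A B r c ≡ sylvesterMatrix k l A' B' r c
    upper r<l = trans (sylvesterMatrix-upper k l A B r c r<l)
      (trans (A≗A' _) (sym (sylvesterMatrix-upper k l A' B' r c r<l)))
    lower : ¬ r < l → sylvesterMatrix k l A B r c ≡ sylvesterMatrix k l A' B' r c
    lower r≮l = trans (sylvesterMatrix-lower k l A B r c r≮l)
      (trans (B≗B' _) (sym (sylvesterMatrix-lower k l A' B' r c r≮l)))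

  resultant-cong : ∀ k l {A A' B B'} → (∀ z → A z ≡ A' z) → (∀ z → B z ≡ B' z) →
    resultant k l A B ≡ resultant k l A' B'
  resultant-cong k l A≗A' B≗B' = det-cong (k ℕ.+ l) λ r c _ _ → sylvesterMatrix-cong k l A≗A' B≗B' r c

  -- The first column has the single entry B l, in row l.
  resultant-leadingZero : ∀ k l A B → Degree≤ A k → Degree≤ B l →
    resultant (suc k) l A B ≡ sign l * B (+ l) * resultant k l A B
  resultant-leadingZero k l A B degreeA degreeB =
    trans (det-firstColumnSingle (k ℕ.+ l) M l (s≤s (m≤n+m l k)) firstColumn)
      (cong₂ (λ u v → sign l * u * v) (sylvesterMatrix-lower (suc k) l A B l 0 (<-irrefl refl))
        (det-cong (k ℕ.+ l) λ r c _ _ → minorEntry r c))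
    where
    M = sylvesterMatrix (suc k) l A B
    firstColumn : ∀ r → r < suc (k ℕ.+ l) → r ≢ l → M r 0 ≡ 0#
    firstColumn r _ r≢l = [ upper , lower ]′ (toSum (r <? l))
      where
      upper : r < l → M r 0 ≡ 0#
      upper r<l = trans (sylvesterMatrix-upper (suc k) l A B r 0 r<l) (degreeA (suc k ℕ.+ r) (s≤s (m≤m+n k r)))
      lower : ¬ r < l → M r 0 ≡ 0#
      lower r≮l = trans (sylvesterMatrix-lower (suc k) l A B r 0 r≮l)
        (degreeB r (≤∧≢⇒< (≮⇒≥ r≮l) (r≢l ∘ sym)))
    minorEntry : ∀ r c → minor M l 0 r c ≡ sylvesterMatrix k l A B r c
    minorEntry r c = [ upper , lower ]′ (toSum (r <? l))
      where
      upper : r < l → minor M l 0 r c ≡ sylvesterMatrix k l A B r c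
      upper r<l = begin
        M (punchIn l r) (suc c)           ≡⟨ cong (λ z → M z (suc c)) (punchIn-below l r r<l) ⟩
        M r (suc c)                       ≡⟨ sylvesterMatrix-upper (suc k) l A B r (suc c) r<l ⟩
        A ((suc k ℕ.+ r) ⊖ suc c)         ≡⟨ cong A ([1+m]⊖[1+n]≡m⊖n (k ℕ.+ r) c) ⟩
        A ((k ℕ.+ r) ⊖ c)                 ≡⟨ sylvesterMatrix-upper k l A B r c r<l ⟨
        sylvesterMatrix k l A B r c       ∎
      lower : ¬ r < l → minor M l 0 r c ≡ sylvesterMatrix k l A B r c
      lower r≮l = begin
        M (punchIn l r) (suc c)           ≡⟨ cong (λ z → M z (suc c)) (punchIn-above l r (≮⇒≥ r≮l)) ⟩
        M (suc r) (suc c)                 ≡⟨ sylvesterMatrix-lower (suc k) l A B (suc r) (suc c) (r≮l ∘ <-trans (n<1+n r)) ⟩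
        B (suc r ⊖ suc c)                 ≡⟨ cong B ([1+m]⊖[1+n]≡m⊖n r c) ⟩
        B (r ⊖ c)                         ≡⟨ sylvesterMatrix-lower k l A B r c r≮l ⟨
        sylvesterMatrix k l A B r c       ∎

  resultant-constant : ∀ l A B → NoNegativePowers A → Degree≤ A 0 → resultant 0 l A B ≡ A (+ 0) ^ l
  resultant-constant l A B noNegative degree = det-diagonal l _ (A (+ 0))
    (λ r r<l → trans (sylvesterMatrix-upper 0 l A B r r r<l) (cong A (n⊖n≡0 r)))
    (λ r c r<l _ r≢c → trans (sylvesterMatrix-upper 0 l A B r c r<l) (offDiagonal r c r≢c))
    where
    offDiagonal : ∀ r c → r ≢ c → A (r ⊖ c) ≡ 0#
    offDiagonal r c r≢c with <-cmp r c
    ... | tri< r<c _ _ = noNegativePowers-⊖ A noNegative r c r<c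
    ... | tri≈ _ r≡c _ = contradiction r≡c r≢c
    ... | tri> _ _ c<r = degree≤-⊖ A 0 degree r c (subst (_< r) (sym (ℕₚ.+-identityʳ c)) c<r)

  onUpperRows : ℕ → R → ℕ → R
  onUpperRows l γ r with r <? l
  ... | yes _ = γ
  ... | no _ = 0#

  onUpperRows-upper : ∀ l γ r → r < l → onUpperRows l γ r ≡ γ
  onUpperRows-upper l γ r r<l with r <? l
  ... | yes _ = refl
  ... | no r≮l = contradiction r<l r≮l

  onUpperRows-lower : ∀ l γ r → ¬ r < l → onUpperRows l γ r ≡ 0#
  onUpperRows-lower l γ r r≮l with r <? l
  ... | yes r<l = contradiction r<l r≮l
  ... | no _ = refl

  -- Replacing A by A + (γ₁ X + γ₀) B adds multiples of the B-rows below to each A-row.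
  resultant-euclidStep : ∀ l A A' B (γ₁ γ₀ : R) → (∀ z → A' z ≡ A z + γ₁ * B (ℤ.pred z) + γ₀ * B z) →
    resultant (suc l) l A' B ≡ resultant (suc l) l A B
  resultant-euclidStep l A A' B γ₁ γ₀ A'≡ =
    det-rowSweep n M M' (l ℕ.+_) (suc l ℕ.+_) (onUpperRows l γ₁) (onUpperRows l γ₀)
      (admissible γ₁ (l ℕ.+_) (λ r<l → s≤s (+-monoʳ-≤ l (<⇒≤ r<l))) (λ r r<l → <-≤-trans r<l (m≤m+n l r)))
      (admissible γ₀ (suc l ℕ.+_) (+-monoʳ-< (suc l)) (λ r _ → m<n+m r z<s))
      rowIdentity
    where
    n = suc l ℕ.+ l
    M = sylvesterMatrix (suc l) l A B
    M' = sylvesterMatrix (suc l) l A' B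
    admissible : ∀ γ (ρ : ℕ → ℕ) → (∀ {r} → r < l → ρ r < n) → (∀ r → r < l → r < ρ r) →
      ∀ r → r < n → Admissible n r (onUpperRows l γ r) (ρ r)
    admissible γ ρ ρ<n r<ρ r _ =
      [ (λ r<l → inj₂ (ρ<n r<l , <⇒≢ (r<ρ r r<l) ∘ sym)) , inj₁ ∘ onUpperRows-lower l γ r ]′ (toSum (r <? l))
    bRow : ∀ s r c → r ≤ s → ¬ s < l → updateRowsBelow r M' M s c ≡ B (s ⊖ c)
    bRow s r c r≤s s≮l = trans (updateColumnsBelow-above r _ _ c s (≤⇒≯ r≤s))
      (sylvesterMatrix-lower (suc l) l A B s c s≮l)
    rowIdentity : ∀ r c → r < n →
      M' r c ≡ M r c + onUpperRows l γ₁ r * updateRowsBelow r M' M (l ℕ.+ r) c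
                     + onUpperRows l γ₀ r * updateRowsBelow r M' M (suc l ℕ.+ r) c
    rowIdentity r c _ = [ upper , lower ]′ (toSum (r <? l))
      where
      u₁ = updateRowsBelow r M' M (l ℕ.+ r) c
      u₀ = updateRowsBelow r M' M (suc l ℕ.+ r) c
      upper : r < l → M' r c ≡ M r c + onUpperRows l γ₁ r * u₁ + onUpperRows l γ₀ r * u₀
      upper r<l = begin
        M' r c                                   ≡⟨ sylvesterMatrix-upper (suc l) l A' B r c r<l ⟩
        A' ((suc l ℕ.+ r) ⊖ c)                   ≡⟨ A'≡ _ ⟩
        A ((suc l ℕ.+ r) ⊖ c) + γ₁ * B (ℤ.pred ((suc l ℕ.+ r) ⊖ c)) + γ₀ * B ((suc l ℕ.+ r) ⊖ c)
          ≡⟨ cong₂ (λ u v → u + γ₁ * B v + γ₀ * B ((suc l ℕ.+ r) ⊖ c))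
               (sylvesterMatrix-upper (suc l) l A B r c r<l) (sym (pred-[1+m]⊖n (l ℕ.+ r) c)) ⟨
        M r c + γ₁ * B ((l ℕ.+ r) ⊖ c) + γ₀ * B ((suc l ℕ.+ r) ⊖ c)
          ≡⟨ cong₂ (λ u v → M r c + u + v)
               (cong₂ _*_ (onUpperRows-upper l γ₁ r r<l) (bRow (l ℕ.+ r) r c (m≤n+m r l) (≤⇒≯ (m≤m+n l r))))
               (cong₂ _*_ (onUpperRows-upper l γ₀ r r<l)
                 (bRow (suc l ℕ.+ r) r c (m≤n+m r (suc l)) (<-asym (s≤s (m≤m+n l r))))) ⟨
        M r c + onUpperRows l γ₁ r * u₁ + onUpperRows l γ₀ r * u₀ ∎
      lower : ¬ r < l → M' r c ≡ M r c + onUpperRows l γ₁ r * u₁ + onUpperRows l γ₀ r * u₀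
      lower r≮l = begin
        M' r c                   ≡⟨ sylvesterMatrix-lower (suc l) l A' B r c r≮l ⟩
        B (r ⊖ c)                ≡⟨ sylvesterMatrix-lower (suc l) l A B r c r≮l ⟨
        M r c                    ≡⟨ +-identityʳ _ ⟨
        M r c + 0#               ≡⟨ +-identityʳ _ ⟨
        M r c + 0# + 0#          ≡⟨ cong₂ (λ u v → M r c + u + v) (zeroˡ u₁) (zeroˡ u₀) ⟨
        M r c + 0# * u₁ + 0# * u₀ ≡⟨ cong₂ (λ u v → M r c + u * u₁ + v * u₀)
                                      (onUpperRows-lower l γ₁ r r≮l) (onUpperRows-lower l γ₀ r r≮l) ⟨
        M r c + onUpperRows l γ₁ r * u₁ + onUpperRows l γ₀ r * u₀ ∎

  eval : ℕ → Poly → R → R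
  eval n P x = ∑[ j < n ] (P (+ j) * x ^ j)

  -- Synthetic division of B by X + α: the coefficient of the quotient at -1 is the remainder B(-α).
  quotient : ℕ → Poly → R → Poly
  quotient l B α z = ∑[ j < suc l ] (B (z ℤ.+ + suc j) * (- α) ^ j)

  quotient-remainder : ∀ l B α → quotient l B α -[1+ 0 ] ≡ eval (suc l) B (- α)
  quotient-remainder l B α = refl

  quotient-degree : ∀ l B α → Degree≤ B l → ∀ i → l ≤ i → quotient l B α (+ i) ≡ 0#
  quotient-degree l B α degree i l≤i = sum-zero (suc l) λ j _ →
    trans (cong (_* (- α) ^ j) (degree (i ℕ.+ suc j) (subst (l <_) (sym (ℕₚ.+-suc i j)) (s≤s (≤-trans l≤i (m≤m+n i j))))))
      (zeroˡ _)

  quotient-spec : ∀ l B α → Degree≤ B l →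
    ∀ i → B (+ i) ≡ quotient l B α (ℤ.pred (+ i)) + α * quotient l B α (+ i)
  quotient-spec l B α degree i = sym (begin
    quotient l B α (ℤ.pred (+ i)) + α * quotient l B α (+ i)
      ≡⟨ cong₂ _+_ (sum-cong (suc l) λ j _ → cong (λ z → B z * (- α) ^ j) (shift (+ i) (+ j)))
           (trans (*-distribˡ-sum (suc l) α (λ j → B (+ i ℤ.+ + suc j) * (- α) ^ j))
             (sum-cong (suc l) λ j _ → nextTerm (B (+ i ℤ.+ + suc j)) ((- α) ^ j))) ⟩
    sum (suc l) t + ∑[ j < suc l ] (- t (suc j))   ≡⟨ sum-distrib-+ (suc l) t (λ j → - t (suc j)) ⟨
    ∑[ j < suc l ] (t j + - t (suc j))             ≡⟨ sum-telescope (suc l) t ⟩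
    t 0 + - t (suc l)                              ≡⟨ cong₂ (λ u v → B u * 1# + - (v * (- α) ^ suc l))
                                                       (ℤₚ.+-identityʳ (+ i)) (degree (i ℕ.+ suc l) (m≤n+m (suc l) i)) ⟩
    B (+ i) * 1# + - (0# * (- α) ^ suc l)          ≡⟨ cong₂ _+_ (*-identityʳ _) (trans (cong -_ (zeroˡ _)) ε⁻¹≈ε) ⟩
    B (+ i) + 0#                                   ≡⟨ +-identityʳ _ ⟩
    B (+ i)                                        ∎)
    where
    t : ℕ → R
    t j = B (+ i ℤ.+ + j) * (- α) ^ j
    shift : ∀ z j → (ℤ.-1ℤ ℤ.+ z) ℤ.+ (ℤ.1ℤ ℤ.+ j) ≡ z ℤ.+ j
    shift = ℤ-Solver.solve-∀
    nextTerm : ∀ b p → α * (b * p) ≡ - (b * (- α * p))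
    nextTerm b p = begin
      α * (b * p)        ≡⟨ solve 3 (λ α b p → α :* (b :* p) := b :* (α :* p)) refl α b p ⟩
      b * (α * p)        ≡⟨ ⁻¹-involutive _ ⟨
      - - (b * (α * p))  ≡⟨ cong -_ (-‿distribʳ-* b (α * p)) ⟩
      - (b * - (α * p))  ≡⟨ cong (λ z → - (b * z)) (-‿distribˡ-* α p) ⟩
      - (b * (- α * p))  ∎

  data RowBlock (l m r : ℕ) : Set where
    upper  : r < l → RowBlock l m r
    middle : ¬ r < l → r < m → RowBlock l m r
    bottom : ¬ r < l → ¬ r < m → RowBlock l m r

  rowBlock : ∀ l m r → RowBlock l m r
  rowBlock l m r with r <? l | r <? m
  ... | yes r<l | _ = upper r<l
  ... | no r≮l | yes r<m = middle r≮l r<m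
  ... | no r≮l | no r≮m = bottom r≮l r≮m

  byRowBlock : ℕ → ℕ → ℕ → R → R → R → R
  byRowBlock l m r a b c with r <? l | r <? m
  ... | yes _ | _ = a
  ... | no _ | yes _ = b
  ... | no _ | no _ = c

  byRowBlock-upper : ∀ {l m r a b c} → r < l → byRowBlock l m r a b c ≡ a
  byRowBlock-upper {l} {m} {r} r<l with r <? l | r <? m
  ... | yes _ | _ = refl
  ... | no r≮l | _ = contradiction r<l r≮l

  byRowBlock-middle : ∀ {l m r a b c} → ¬ r < l → r < m → byRowBlock l m r a b c ≡ b
  byRowBlock-middle {l} {m} {r} r≮l r<m with r <? l | r <? m
  ... | yes r<l | _ = contradiction r<l r≮l
  ... | no _ | yes _ = refl
  ... | no _ | no r≮m = contradiction r<m r≮m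

  byRowBlock-bottom : ∀ {l m r a b c} → ¬ r < l → ¬ r < m → byRowBlock l m r a b c ≡ c
  byRowBlock-bottom {l} {m} {r} r≮l r≮m with r <? l | r <? m
  ... | yes r<l | _ = contradiction r<l r≮l
  ... | no _ | yes r<m = contradiction r<m r≮m
  ... | no _ | no _ = refl

  x+0*u≡x : ∀ x u → x + 0# * u ≡ x
  x+0*u≡x x u = trans (cong (λ w → x + w) (zeroˡ u)) (+-identityʳ x)

  x+u*0≡x : ∀ x u → x + u * 0# ≡ x
  x+u*0≡x x u = trans (cong (λ w → x + w) (zeroʳ u)) (+-identityʳ x)

  x+0*u+0*v≡x : ∀ x u v → x + 0# * u + 0# * v ≡ x
  x+0*u+0*v≡x x u v = trans (x+0*u≡x _ v) (x+0*u≡x x u)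

  x≡y+α*z⇒y≡x+-α*z : ∀ {x y} α z → x ≡ y + α * z → y ≡ x + - α * z
  x≡y+α*z⇒y≡x+-α*z {x} {y} α z x≡ = sym (begin
    x + - α * z              ≡⟨ cong₂ _+_ x≡ (sym (-‿distribˡ-* α z)) ⟩
    y + α * z + - (α * z)    ≡⟨ +-assoc _ _ _ ⟩
    y + (α * z + - (α * z))  ≡⟨ cong (λ w → y + w) (-‿inverseʳ _) ⟩
    y + 0#                   ≡⟨ +-identityʳ y ⟩
    y                        ∎)

  -- res((X + α) S, B) = B(-α) res(S, B): adding α times the next row to every B-row but the last,
  -- and then subtracting α times column c - 1 from column c from left to right, turns the A-rows
  -- into S-rows and the last B-row into the quotient of B by X + α, whose remainder B(-α) is left
  -- alone in the last column.
  module _ (k l : ℕ) (α : R) {S A B : Poly}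
    (noNegativeS : NoNegativePowers S) (degreeS : Degree≤ S k)
    (noNegativeB : NoNegativePowers B) (degreeB : Degree≤ B l)
    (A≡ : ∀ z → A z ≡ S (ℤ.pred z) + α * S z) where

    private
      m = k ℕ.+ l
      Q = quotient l B α
      M₀ M₁ M₂ : Matrix
      M₀ = sylvesterMatrix (suc k) l A B
      M₁ r c = byRowBlock l m r (A ((suc k ℕ.+ r) ⊖ c)) (B (r ⊖ c) + α * B (suc r ⊖ c)) (B (r ⊖ c))
      M₂ r c = byRowBlock l m r (S ((k ℕ.+ r) ⊖ c)) (B (r ⊖ c)) (Q (ℤ.pred (r ⊖ c)))

      rowsCombined : det (suc m) M₁ ≡ det (suc m) M₀
      rowsCombined = det-rowSweep (suc m) M₀ M₁ suc suc coefficient (λ _ → 0#) admissible (λ _ _ → inj₁ refl) rowIdentity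
        where
        coefficient : ℕ → R
        coefficient r = byRowBlock l m r 0# α 0#
        admissible : ∀ r → r < suc m → Admissible (suc m) r (coefficient r) (suc r)
        admissible r _ with rowBlock l m r
        ... | upper r<l = inj₁ (byRowBlock-upper r<l)
        ... | middle _ r<m = inj₂ (s≤s r<m , <⇒≢ (n<1+n r) ∘ sym)
        ... | bottom r≮l r≮m = inj₁ (byRowBlock-bottom r≮l r≮m)
        rowIdentity : ∀ r c → r < suc m →
          M₁ r c ≡ M₀ r c + coefficient r * updateRowsBelow r M₁ M₀ (suc r) c + 0# * updateRowsBelow r M₁ M₀ (suc r) c
        rowIdentity r c _ = byBlock (rowBlock l m r)
          where
          next = updateRowsBelow r M₁ M₀ (suc r) c
          unchanged : coefficient r ≡ 0# → M₁ r c ≡ M₀ r c → M₁ r c ≡ M₀ r c + coefficient r * next + 0# * next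
          unchanged noCoefficient same = trans same (sym (trans (cong (λ w → M₀ r c + w * next + 0# * next) noCoefficient)
            (x+0*u+0*v≡x _ _ _)))
          byBlock : RowBlock l m r → M₁ r c ≡ M₀ r c + coefficient r * next + 0# * next
          byBlock (upper r<l) = unchanged (byRowBlock-upper r<l)
            (trans (byRowBlock-upper r<l) (sym (sylvesterMatrix-upper (suc k) l A B r c r<l)))
          byBlock (middle r≮l r<m) = begin
            M₁ r c                                  ≡⟨ byRowBlock-middle r≮l r<m ⟩
            B (r ⊖ c) + α * B (suc r ⊖ c)           ≡⟨ cong₂ (λ u v → u + α * v)
                                                         (sym (sylvesterMatrix-lower (suc k) l A B r c r≮l))
                                                         (sym (trans (updateColumnsBelow-above r _ _ c (suc r) (<-asym (n<1+n r)))
                                                           (sylvesterMatrix-lower (suc k) l A B (suc r) c (r≮l ∘ <-trans (n<1+n r))))) ⟩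
            M₀ r c + α * next                       ≡⟨ cong (λ w → M₀ r c + w * next) (byRowBlock-middle r≮l r<m) ⟨
            M₀ r c + coefficient r * next           ≡⟨ x+0*u≡x _ next ⟨
            M₀ r c + coefficient r * next + 0# * next ∎
          byBlock (bottom r≮l r≮m) = unchanged (byRowBlock-bottom r≮l r≮m)
            (trans (byRowBlock-bottom r≮l r≮m) (sym (sylvesterMatrix-lower (suc k) l A B r c r≮l)))

      firstColumnAgrees : ∀ r → M₂ r 0 ≡ M₁ r 0
      firstColumnAgrees r with rowBlock l m r
      ... | upper r<l = begin
        M₂ r 0                                    ≡⟨ byRowBlock-upper r<l ⟩
        S ((k ℕ.+ r) ⊖ 0)                         ≡⟨ x+u*0≡x _ α ⟨
        S ((k ℕ.+ r) ⊖ 0) + α * 0#                ≡⟨ cong₂ (λ u v → S u + α * v) (pred-[1+m]⊖n (k ℕ.+ r) 0)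
                                                       (degree≤-⊖ S k degreeS (suc k ℕ.+ r) 0 (s≤s (m≤m+n k r))) ⟨
        S (ℤ.pred ((suc k ℕ.+ r) ⊖ 0)) + α * S ((suc k ℕ.+ r) ⊖ 0) ≡⟨ A≡ _ ⟨
        A ((suc k ℕ.+ r) ⊖ 0)                     ≡⟨ byRowBlock-upper r<l ⟨
        M₁ r 0                                    ∎
      ... | middle r≮l r<m = begin
        M₂ r 0                                    ≡⟨ byRowBlock-middle r≮l r<m ⟩
        B (r ⊖ 0)                                 ≡⟨ x+u*0≡x _ α ⟨
        B (r ⊖ 0) + α * 0#                        ≡⟨ cong (λ w → B (r ⊖ 0) + α * w)
                                                       (degree≤-⊖ B l degreeB (suc r) 0 (s≤s (≮⇒≥ r≮l))) ⟨
        B (r ⊖ 0) + α * B (suc r ⊖ 0)             ≡⟨ byRowBlock-middle r≮l r<m ⟨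
        M₁ r 0                                    ∎
      ... | bottom r≮l r≮m = begin
        M₂ r 0                                    ≡⟨ byRowBlock-bottom r≮l r≮m ⟩
        Q (ℤ.pred (r ⊖ 0))                        ≡⟨ cong (λ z → Q (ℤ.pred z)) (m⊖0≡+m r) ⟩
        Q (ℤ.pred (+ r))                          ≡⟨ x+u*0≡x _ α ⟨
        Q (ℤ.pred (+ r)) + α * 0#                 ≡⟨ cong (λ w → Q (ℤ.pred (+ r)) + α * w)
                                                       (quotient-degree l B α degreeB r (≮⇒≥ r≮l)) ⟨
        Q (ℤ.pred (+ r)) + α * Q (+ r)            ≡⟨ quotient-spec l B α degreeB r ⟨
        B (+ r)                                   ≡⟨ cong B (m⊖0≡+m r) ⟨
        B (r ⊖ 0)                                 ≡⟨ byRowBlock-bottom r≮l r≮m ⟨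
        M₁ r 0                                    ∎

      columnRecurrence : ∀ r c → suc c < suc m → M₁ r (suc c) ≡ M₂ r (suc c) + α * M₂ r c
      columnRecurrence r c (s≤s c<m) with rowBlock l m r
      ... | upper r<l = begin
        M₁ r (suc c)                              ≡⟨ byRowBlock-upper r<l ⟩
        A ((suc k ℕ.+ r) ⊖ suc c)                 ≡⟨ A≡ _ ⟩
        S (ℤ.pred ((suc k ℕ.+ r) ⊖ suc c)) + α * S ((suc k ℕ.+ r) ⊖ suc c)
          ≡⟨ cong₂ (λ u v → S u + α * S v) (trans (cong ℤ.pred ([1+m]⊖[1+n]≡m⊖n (k ℕ.+ r) c)) (pred-⊖ (k ℕ.+ r) c))
               ([1+m]⊖[1+n]≡m⊖n (k ℕ.+ r) c) ⟩
        S ((k ℕ.+ r) ⊖ suc c) + α * S ((k ℕ.+ r) ⊖ c)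
          ≡⟨ cong₂ (λ u v → u + α * v) (byRowBlock-upper r<l) (byRowBlock-upper r<l) ⟨
        M₂ r (suc c) + α * M₂ r c                 ∎
      ... | middle r≮l r<m = begin
        M₁ r (suc c)                              ≡⟨ byRowBlock-middle r≮l r<m ⟩
        B (r ⊖ suc c) + α * B (suc r ⊖ suc c)     ≡⟨ cong (λ z → B (r ⊖ suc c) + α * B z) ([1+m]⊖[1+n]≡m⊖n r c) ⟩
        B (r ⊖ suc c) + α * B (r ⊖ c)
          ≡⟨ cong₂ (λ u v → u + α * v) (byRowBlock-middle r≮l r<m) (byRowBlock-middle r≮l r<m) ⟨
        M₂ r (suc c) + α * M₂ r c                 ∎
      ... | bottom r≮l r≮m = begin
        M₁ r (suc c)                              ≡⟨ byRowBlock-bottom r≮l r≮m ⟩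
        B (r ⊖ suc c)                             ≡⟨ cong B r⊖1+c ⟩
        B (+ (r ℕ.∸ suc c))                       ≡⟨ quotient-spec l B α degreeB (r ℕ.∸ suc c) ⟩
        Q (ℤ.pred (+ (r ℕ.∸ suc c))) + α * Q (+ (r ℕ.∸ suc c))
          ≡⟨ cong₂ (λ u v → Q (ℤ.pred u) + α * Q v) (sym r⊖1+c) (trans (sym r⊖1+c) (sym (pred-⊖ r c))) ⟩
        Q (ℤ.pred (r ⊖ suc c)) + α * Q (ℤ.pred (r ⊖ c))
          ≡⟨ cong₂ (λ u v → u + α * v) (byRowBlock-bottom r≮l r≮m) (byRowBlock-bottom r≮l r≮m) ⟨
        M₂ r (suc c) + α * M₂ r c                 ∎
        where
        r⊖1+c : r ⊖ suc c ≡ + (r ℕ.∸ suc c)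
        r⊖1+c = ⊖-≥ (≤-trans c<m (≮⇒≥ r≮m))

      columnsReduced : det (suc m) M₂ ≡ det (suc m) M₁
      columnsReduced = det-columnSweep (suc m) M₁ M₂ ℕ.pred ℕ.pred coefficient (λ _ → 0#) admissible (λ _ _ → inj₁ refl)
        columnIdentity
        where
        coefficient : ℕ → R
        coefficient zero = 0#
        coefficient (suc c) = - α
        admissible : ∀ c → c < suc m → Admissible (suc m) c (coefficient c) (ℕ.pred c)
        admissible zero _ = inj₁ refl
        admissible (suc c) 1+c<1+m = inj₂ (<-trans (n<1+n c) 1+c<1+m , <⇒≢ (n<1+n c))
        columnIdentity : ∀ r c → c < suc m →
          M₂ r c ≡ M₁ r c + coefficient c * updateColumnsBelow c M₂ M₁ r (ℕ.pred c)
                          + 0# * updateColumnsBelow c M₂ M₁ r (ℕ.pred c)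
        columnIdentity r zero _ = trans (firstColumnAgrees r) (sym (x+0*u+0*v≡x _ _ _))
        columnIdentity r (suc c) 1+c<1+m = begin
          M₂ r (suc c)                         ≡⟨ x≡y+α*z⇒y≡x+-α*z α (M₂ r c) (columnRecurrence r c 1+c<1+m) ⟩
          M₁ r (suc c) + - α * M₂ r c
            ≡⟨ cong (λ w → M₁ r (suc c) + - α * w) (updateColumnsBelow-below (suc c) M₂ M₁ r c (n<1+n c)) ⟨
          M₁ r (suc c) + - α * previous        ≡⟨ x+0*u≡x _ previous ⟨
          M₁ r (suc c) + - α * previous + 0# * previous ∎
          where
          previous = updateColumnsBelow (suc c) M₂ M₁ r c

      lastColumn : ∀ r → r < m → M₂ r m ≡ 0#
      lastColumn r r<m with rowBlock l m r
      ... | upper r<l = trans (byRowBlock-upper r<l) (noNegativePowers-⊖ S noNegativeS (k ℕ.+ r) m (+-monoʳ-< k r<l))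
      ... | middle r≮l r<m = trans (byRowBlock-middle r≮l r<m) (noNegativePowers-⊖ B noNegativeB r m r<m)
      ... | bottom _ r≮m = contradiction r<m r≮m

      corner : M₂ m m ≡ eval (suc l) B (- α)
      corner = trans (byRowBlock-bottom (≤⇒≯ (m≤n+m l k)) (<-irrefl refl))
        (trans (cong (λ z → Q (ℤ.pred z)) (n⊖n≡0 m)) (quotient-remainder l B α))

      leadingBlock : det m M₂ ≡ resultant k l S B
      leadingBlock = det-cong m λ r c r<m _ → entry r c r<m
        where
        entry : ∀ r c → r < m → M₂ r c ≡ sylvesterMatrix k l S B r c
        entry r c r<m with rowBlock l m r
        ... | upper r<l = trans (byRowBlock-upper r<l) (sym (sylvesterMatrix-upper k l S B r c r<l))
        ... | middle r≮l r<m = trans (byRowBlock-middle r≮l r<m) (sym (sylvesterMatrix-lower k l S B r c r≮l))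
        ... | bottom _ r≮m = contradiction r<m r≮m

    resultant-linearFactor : resultant (suc k) l A B ≡ eval (suc l) B (- α) * resultant k l S B
    resultant-linearFactor = begin
      det (suc m) M₀     ≡⟨ rowsCombined ⟨
      det (suc m) M₁     ≡⟨ columnsReduced ⟨
      det (suc m) M₂     ≡⟨ det-lastColumnAboveZero m M₂ lastColumn ⟩
      M₂ m m * det m M₂  ≡⟨ cong₂ _*_ corner leadingBlock ⟩
      eval (suc l) B (- α) * resultant k l S B ∎

module PowerCombinations {R : Set} {add mul : R → R → R} {neg : R → R} {0r 1r : R}
  (isCommutativeRing : IsCommutativeRing _≡_ add mul neg 0r 1r) where

  open import Data.Nat as ℕ using (ℕ; zero; suc; z≤n; s≤s; _<_; _≤_; _∸_)
  open import Data.Nat.Properties using (n<1+n; <-trans; m≤n⇒m<n∨m≡n; +-∸-assoc; n∸n≡0)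
  open import Data.Nat.Combinatorics using (_C_; nCn≡1; nCk+nC[k+1]≡[n+1]C[k+1])
  open import Data.Integer as ℤ using (ℤ; +_; -[1+_])
  open import Data.Sum using (inj₁; inj₂)

  open SylvesterResultants isCommutativeRing public
  open import Algebra.Bundles using (CommutativeRing)
  open import Algebra.Properties.Semiring.Mult (CommutativeRing.semiring commutativeRing) public using (_×_; ×-homo-+)
  open ≡-Reasoning

  linearPower : R → ℕ → Poly
  linearPower β zero (+ zero) = 1#
  linearPower β zero (+ suc _) = 0#
  linearPower β zero -[1+ _ ] = 0#
  linearPower β (suc k) z = linearPower β k (ℤ.pred z) + β * linearPower β k z

  linearPower-noNegativePowers : ∀ β k → NoNegativePowers (linearPower β k)
  linearPower-noNegativePowers β zero i = refl
  linearPower-noNegativePowers β (suc k) i =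
    trans (cong₂ (λ u v → u + β * v) (linearPower-noNegativePowers β k (suc i)) (linearPower-noNegativePowers β k i))
      (x+u*0≡x 0# β)

  linearPower-degree : ∀ β k → Degree≤ (linearPower β k) k
  linearPower-degree β zero (suc i) _ = refl
  linearPower-degree β (suc k) (suc i) (s≤s k<i) =
    trans (cong₂ (λ u v → u + β * v) (linearPower-degree β k i k<i) (linearPower-degree β k (suc i) (<-trans k<i (n<1+n i))))
      (x+u*0≡x 0# β)

  linearPower-leading : ∀ β k → linearPower β k (+ k) ≡ 1#
  linearPower-leading β zero = refl
  linearPower-leading β (suc k) =
    trans (cong₂ (λ u v → u + β * v) (linearPower-leading β k) (linearPower-degree β k (suc k) (n<1+n k)))
      (x+u*0≡x 1# β)

  linearPower-coefficient : ∀ β k i → i ≤ k → linearPower β k (+ i) ≡ (k C i) × 1# * β ^ (k ∸ i)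
  linearPower-coefficient β zero zero _ = sym (trans (*-identityʳ _) (+-identityʳ _))
  linearPower-coefficient β (suc k) zero _ = begin
    linearPower β k -[1+ 0 ] + β * linearPower β k (+ 0)   ≡⟨ cong₂ (λ u v → u + β * v) (linearPower-noNegativePowers β k 0)
                                                                (linearPower-coefficient β k 0 z≤n) ⟩
    0# + β * ((1# + 0#) * β ^ k)                           ≡⟨ solve 3 (λ β one p → con 0 :+ β :* (one :* p) := one :* (β :* p))
                                                                refl β (1# + 0#) (β ^ k) ⟩
    (1# + 0#) * (β * β ^ k)                                ∎
  linearPower-coefficient β (suc k) (suc i) (s≤s i≤k) with m≤n⇒m<n∨m≡n i≤k
  ... | inj₁ i<k = begin
    linearPower β k (+ i) + β * linearPower β k (+ suc i)
      ≡⟨ cong₂ (λ u v → u + β * v) (linearPower-coefficient β k i i≤k) (linearPower-coefficient β k (suc i) i<k) ⟩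
    (k C i) × 1# * β ^ (k ∸ i) + β * ((k C suc i) × 1# * β ^ (k ∸ suc i))
      ≡⟨ cong (λ e → (k C i) × 1# * β ^ e + β * ((k C suc i) × 1# * β ^ (k ∸ suc i))) k∸i ⟩
    (k C i) × 1# * (β * β ^ (k ∸ suc i)) + β * ((k C suc i) × 1# * β ^ (k ∸ suc i))
      ≡⟨ solve 4 (λ u v β p → u :* (β :* p) :+ β :* (v :* p) := (u :+ v) :* (β :* p)) refl
           ((k C i) × 1#) ((k C suc i) × 1#) β (β ^ (k ∸ suc i)) ⟩
    ((k C i) × 1# + (k C suc i) × 1#) * (β * β ^ (k ∸ suc i))
      ≡⟨ cong₂ (λ u e → u * β ^ e)
           (trans (sym (×-homo-+ 1# (k C i) (k C suc i))) (cong (_× 1#) (nCk+nC[k+1]≡[n+1]C[k+1] k i))) (sym k∸i) ⟩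
    (suc k C suc i) × 1# * β ^ (k ∸ i) ∎
    where
    k∸i : k ∸ i ≡ suc (k ∸ suc i)
    k∸i = +-∸-assoc 1 i<k
  ... | inj₂ refl = begin
    linearPower β i (+ i) + β * linearPower β i (+ suc i)
      ≡⟨ cong₂ (λ u v → u + β * v) (linearPower-leading β i) (linearPower-degree β i (suc i) (n<1+n i)) ⟩
    1# + β * 0#                           ≡⟨ x+u*0≡x 1# β ⟩
    1#                                    ≡⟨ trans (*-identityʳ _) (+-identityʳ _) ⟨
    1 × 1# * 1#                           ≡⟨ cong₂ (λ n e → n × 1# * β ^ e) (nCn≡1 (suc i)) (n∸n≡0 i) ⟨
    (suc i C suc i) × 1# * β ^ (i ∸ i)    ∎

  eval-linearFactor : ∀ n (S A : Poly) γ x → NoNegativePowers S → S (+ n) ≡ 0# →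
    (∀ z → A z ≡ S (ℤ.pred z) + γ * S z) → eval (suc n) A x ≡ (x + γ) * eval n S x
  eval-linearFactor n S A γ x noNegative topZero A≡ = begin
    A (+ 0) * 1# + ∑[ j < n ] (A (+ suc j) * (x * x ^ j))
      ≡⟨ cong₂ (λ u v → u * 1# + v) (trans (A≡ (+ 0)) (cong (_+ γ * S (+ 0)) (noNegative 0)))
           (sum-cong n λ j _ → trans (cong (_* (x * x ^ j)) (A≡ (+ suc j))) (split (S (+ j)) (S (+ suc j)) (x ^ j))) ⟩
    (0# + γ * S (+ 0)) * 1# + ∑[ j < n ] (x * (S (+ j) * x ^ j) + γ * (S (+ suc j) * (x * x ^ j)))
      ≡⟨ cong (λ w → (0# + γ * S (+ 0)) * 1# + w)
           (trans (sum-distrib-+ n (λ j → x * (S (+ j) * x ^ j)) (λ j → γ * (S (+ suc j) * (x * x ^ j))))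
             (cong₂ _+_ (sym (*-distribˡ-sum n x _)) (sym (*-distribˡ-sum n γ _)))) ⟩
    (0# + γ * S (+ 0)) * 1# + (x * E + γ * T)   ≡⟨ regroup (S (+ 0)) E T ⟩
    x * E + γ * (S (+ 0) * 1# + T)              ≡⟨ cong (λ w → x * E + γ * w) shiftedSum ⟩
    x * E + γ * E                               ≡⟨ distribʳ E x γ ⟨
    (x + γ) * E                                 ∎
    where
    E = eval n S x
    T = ∑[ j < n ] (S (+ suc j) * (x * x ^ j))
    split : ∀ s t p → (s + γ * t) * (x * p) ≡ x * (s * p) + γ * (t * (x * p))
    split = solve 5 (λ γ x s t p → (s :+ γ :* t) :* (x :* p) := x :* (s :* p) :+ γ :* (t :* (x :* p))) refl γ x
    regroup : ∀ s e t → (0# + γ * s) * 1# + (x * e + γ * t) ≡ x * e + γ * (s * 1# + t)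
    regroup = solve 5 (λ γ x s e t → (con 0 :+ γ :* s) :* con 1 :+ (x :* e :+ γ :* t) := x :* e :+ γ :* (s :* con 1 :+ t))
      refl γ x
    shiftedSum : S (+ 0) * 1# + T ≡ E
    shiftedSum = trans (sum-init-last n (λ j → S (+ j) * x ^ j))
      (trans (cong (λ w → E + w * x ^ n) topZero) (trans (cong (λ w → E + w) (zeroˡ (x ^ n))) (+-identityʳ E)))

  eval-linearPower : ∀ β k x → eval (suc k) (linearPower β k) x ≡ (x + β) ^ k
  eval-linearPower β zero x = trans (+-identityʳ _) (*-identityˡ 1#)
  eval-linearPower β (suc k) x =
    trans (eval-linearFactor (suc k) (linearPower β k) (linearPower β (suc k)) β x
            (linearPower-noNegativePowers β k) (linearPower-degree β k (suc k) (n<1+n k)) (λ _ → refl))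
      (cong ((x + β) *_) (eval-linearPower β k x))

  eval-linearCombination : ∀ n (P Q : Poly) a b x →
    eval n (λ z → a * P z + b * Q z) x ≡ a * eval n P x + b * eval n Q x
  eval-linearCombination n P Q a b x = begin
    ∑[ j < n ] ((a * P (+ j) + b * Q (+ j)) * x ^ j)
      ≡⟨ sum-cong n (λ j _ → distribute (P (+ j)) (Q (+ j)) (x ^ j)) ⟩
    ∑[ j < n ] (a * (P (+ j) * x ^ j) + b * (Q (+ j) * x ^ j))
      ≡⟨ sum-distrib-+ n (λ j → a * (P (+ j) * x ^ j)) (λ j → b * (Q (+ j) * x ^ j)) ⟩
    ∑[ j < n ] (a * (P (+ j) * x ^ j)) + ∑[ j < n ] (b * (Q (+ j) * x ^ j))
      ≡⟨ cong₂ _+_ (*-distribˡ-sum n a _) (*-distribˡ-sum n b _) ⟨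
    a * eval n P x + b * eval n Q x ∎
    where
    distribute : ∀ p q y → (a * p + b * q) * y ≡ a * (p * y) + b * (q * y)
    distribute = solve 5 (λ a b p q y → (a :* p :+ b :* q) :* y := a :* (p :* y) :+ b :* (q :* y)) refl a b

  resultant-scaledLinearPower : ∀ k {B} → NoNegativePowers B → Degree≤ B k → ∀ α c i →
    resultant i k (λ z → c * linearPower α i z) B ≡ eval (suc k) B (- α) ^ i * c ^ k
  resultant-scaledLinearPower k {B} noNegativeB degreeB α c zero =
    trans (resultant-constant k _ B (λ j → trans (cong (c *_) (linearPower-noNegativePowers α 0 j)) (zeroʳ c))
            (λ j j>0 → trans (cong (c *_) (linearPower-degree α 0 j j>0)) (zeroʳ c)))
      (trans (cong (_^ k) (*-identityʳ c)) (sym (*-identityˡ _)))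
  resultant-scaledLinearPower k {B} noNegativeB degreeB α c (suc i) = begin
    resultant (suc i) k (λ z → c * linearPower α (suc i) z) B
      ≡⟨ resultant-linearFactor i k α
           (λ j → trans (cong (c *_) (linearPower-noNegativePowers α i j)) (zeroʳ c))
           (λ j i<j → trans (cong (c *_) (linearPower-degree α i j i<j)) (zeroʳ c))
           noNegativeB degreeB (λ z → pushScalar (linearPower α i (ℤ.pred z)) (linearPower α i z)) ⟩
    v * resultant i k (λ z → c * linearPower α i z) B   ≡⟨ cong (v *_) (resultant-scaledLinearPower k noNegativeB degreeB α c i) ⟩
    v * (v ^ i * c ^ k)                                 ≡⟨ *-assoc v (v ^ i) (c ^ k) ⟨
    v ^ suc i * c ^ k                                   ∎
    where
    v = eval (suc k) B (- α)
    pushScalar : ∀ p q → c * (p + α * q) ≡ c * p + α * (c * q)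
    pushScalar = solve 4 (λ c α p q → c :* (p :+ α :* q) := c :* p :+ α :* (c :* q)) refl c α

  powerCombination : R → R → R → R → ℕ → Poly
  powerCombination a b α β n z = a * linearPower α n z + b * linearPower β n z

  module _ (a b α β : R) where

    private
      F = powerCombination a b α β

      a*0+b*0≡0 : a * 0# + b * 0# ≡ 0#
      a*0+b*0≡0 = trans (cong₂ _+_ (zeroʳ a) (zeroʳ b)) (+-identityʳ 0#)

    powerCombination-noNegativePowers : ∀ n → NoNegativePowers (F n)
    powerCombination-noNegativePowers n i =
      trans (cong₂ (λ u v → a * u + b * v) (linearPower-noNegativePowers α n i) (linearPower-noNegativePowers β n i)) a*0+b*0≡0

    powerCombination-degree : ∀ n → Degree≤ (F n) n
    powerCombination-degree n i n<i =
      trans (cong₂ (λ u v → a * u + b * v) (linearPower-degree α n i n<i) (linearPower-degree β n i n<i)) a*0+b*0≡0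

    powerCombination-leading : ∀ n → F n (+ n) ≡ a + b
    powerCombination-leading n =
      trans (cong₂ (λ u v → a * u + b * v) (linearPower-leading α n) (linearPower-leading β n))
        (cong₂ _+_ (*-identityʳ a) (*-identityʳ b))

    powerCombination-suc : ∀ k z →
      F (suc k) z ≡ a * (α + - β) * linearPower α k z + 1# * F k (ℤ.pred z) + β * F k z
    powerCombination-suc k z = begin
      a * (P + α * p) + b * (Q + β * q)
        ≡⟨ solve 8 (λ a b α β P p Q q → a :* (P :+ α :* p) :+ b :* (Q :+ β :* q)
                                        := a :* α :* p :+ a :* P :+ b :* Q :+ b :* β :* q :+ a :* p :* con 0)
             refl a b α β P p Q q ⟩
      a * α * p + a * P + b * Q + b * β * q + a * p * 0#
        ≡⟨ cong (λ w → a * α * p + a * P + b * Q + b * β * q + a * p * w) (-‿inverseˡ β) ⟨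
      a * α * p + a * P + b * Q + b * β * q + a * p * (- β + β)
        ≡⟨ solve 9 (λ a b α δ β P p Q q → a :* α :* p :+ a :* P :+ b :* Q :+ b :* β :* q :+ a :* p :* (δ :+ β)
                                          := a :* (α :+ δ) :* p :+ con 1 :* (a :* P :+ b :* Q) :+ β :* (a :* p :+ b :* q))
             refl a b α (- β) β P p Q q ⟩
      a * (α + - β) * p + 1# * (a * P + b * Q) + β * (a * p + b * q) ∎
      where
      P = linearPower α k (ℤ.pred z)
      p = linearPower α k z
      Q = linearPower β k (ℤ.pred z)
      q = linearPower β k z

    eval-powerCombination : ∀ k → eval (suc k) (F k) (- α) ^ k ≡ (b * (- α + β) ^ k) ^ k
    eval-powerCombination zero = refl
    eval-powerCombination (suc j) = cong (_^ suc j) (begin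
      eval (2 ℕ.+ j) (F (suc j)) (- α)
        ≡⟨ eval-linearCombination (2 ℕ.+ j) (linearPower α (suc j)) (linearPower β (suc j)) a b (- α) ⟩
      a * eval (2 ℕ.+ j) (linearPower α (suc j)) (- α) + b * eval (2 ℕ.+ j) (linearPower β (suc j)) (- α)
        ≡⟨ cong₂ (λ u v → a * u + b * v) (eval-linearPower α (suc j) (- α)) (eval-linearPower β (suc j) (- α)) ⟩
      a * ((- α + α) * (- α + α) ^ j) + b * (- α + β) ^ suc j
        ≡⟨ cong (λ w → a * (w * (- α + α) ^ j) + b * (- α + β) ^ suc j) (-‿inverseˡ α) ⟩
      a * (0# * (- α + α) ^ j) + b * (- α + β) ^ suc j
        ≡⟨ cong (_+ b * (- α + β) ^ suc j) (trans (cong (a *_) (zeroˡ _)) (zeroʳ a)) ⟩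
      0# + b * (- α + β) ^ suc j         ≡⟨ +-identityˡ _ ⟩
      b * (- α + β) ^ suc j               ∎)

    -- One Euclid step to c (X + α)^k, then drop its vanishing leading coefficient.
    resultant-powerCombination : ∀ k → resultant (suc k) k (F (suc k)) (F k)
      ≡ sign k * (a + b) * ((b * (- α + β) ^ k) ^ k * (a * (α + - β)) ^ k)
    resultant-powerCombination k = begin
      resultant (suc k) k (F (suc k)) (F k)
        ≡⟨ resultant-euclidStep k (λ z → c * linearPower α k z) (F (suc k)) (F k) 1# β (powerCombination-suc k) ⟩
      resultant (suc k) k (λ z → c * linearPower α k z) (F k)
        ≡⟨ resultant-leadingZero k k _ (F k)
             (λ i k<i → trans (cong (c *_) (linearPower-degree α k i k<i)) (zeroʳ c)) (powerCombination-degree k) ⟩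
      sign k * F k (+ k) * resultant k k (λ z → c * linearPower α k z) (F k)
        ≡⟨ cong₂ (λ u v → sign k * u * v) (powerCombination-leading k)
             (resultant-scaledLinearPower k (powerCombination-noNegativePowers k) (powerCombination-degree k) α c k) ⟩
      sign k * (a + b) * (eval (suc k) (F k) (- α) ^ k * c ^ k)
        ≡⟨ cong (λ w → sign k * (a + b) * (w * c ^ k)) (eval-powerCombination k) ⟩
      sign k * (a + b) * ((b * (- α + β) ^ k) ^ k * c ^ k) ∎
      where
      c = a * (α + - β)

module EisensteinRationals where

  open import Data.Rational as Q using (ℚ; 0ℚ; 1ℚ)
  open import Data.Rational.Properties using (+-*-commutativeRing) renaming (_≟_ to _≟ℚ_)
  open import Data.Product using (_×_; _,_)
  open import Data.Product.Properties using (≡-dec)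
  open import Data.Maybe using (Maybe; just; nothing)
  open import Relation.Nullary using (yes; no)
  open import Tactic.RingSolver using (solve-∀)
  open import Tactic.RingSolver.Core.AlmostCommutativeRing using (AlmostCommutativeRing; fromCommutativeRing)
  open import Level using (0ℓ)

  ℚ-ring : AlmostCommutativeRing 0ℓ 0ℓ
  ℚ-ring = fromCommutativeRing +-*-commutativeRing isZero
    where
    isZero : ∀ x → Maybe (0ℚ ≡ x)
    isZero x with 0ℚ ≟ℚ x
    ... | yes 0≡x = just 0≡x
    ... | no _ = nothing

  -- (x , y) stands for x + y ω, where ω² = ω - 1 (ω a primitive sixth root of unity).
  ℚ[ω] : Set
  ℚ[ω] = ℚ × ℚ

  private
    infixl 6 _⊕_
    infixl 7 _⊛_

    _⊕_ : ℚ[ω] → ℚ[ω] → ℚ[ω]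
    (a , b) ⊕ (c , d) = (a Q.+ c , b Q.+ d)

    _⊛_ : ℚ[ω] → ℚ[ω] → ℚ[ω]
    (a , b) ⊛ (c , d) = (a Q.* c Q.+ Q.- (b Q.* d) , a Q.* d Q.+ b Q.* c Q.+ b Q.* d)

    ⊝_ : ℚ[ω] → ℚ[ω]
    ⊝ (a , b) = (Q.- a , Q.- b)

    𝟘 𝟙 : ℚ[ω]
    𝟘 = (0ℚ , 0ℚ)
    𝟙 = (1ℚ , 0ℚ)

    isCommutativeRing : IsCommutativeRing _≡_ _⊕_ _⊛_ ⊝_ 𝟘 𝟙
    isCommutativeRing = record
      { isRing = record
        { +-isAbelianGroup = record
          { isGroup = record
            { isMonoid = record
              { isSemigroup = record
                { isMagma = record { isEquivalence = isEquivalence ; ∙-cong = cong₂ _⊕_ }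
                ; assoc = λ { (a , b) (c , d) (e , f) → cong₂ _,_ (assoc+ a c e) (assoc+ b d f) } }
              ; identity = (λ { (a , b) → cong₂ _,_ (identityˡ a) (identityˡ b) })
                         , (λ { (a , b) → cong₂ _,_ (identityʳ a) (identityʳ b) }) }
            ; inverse = (λ { (a , b) → cong₂ _,_ (inverseˡ a) (inverseˡ b) })
                      , (λ { (a , b) → cong₂ _,_ (inverseʳ a) (inverseʳ b) })
            ; ⁻¹-cong = cong ⊝_ }
          ; comm = λ { (a , b) (c , d) → cong₂ _,_ (comm+ a c) (comm+ b d) } }
        ; *-cong = cong₂ _⊛_
        ; *-assoc = λ { (a , b) (c , d) (e , f) → cong₂ _,_ (assoc*₁ a b c d e f) (assoc*₂ a b c d e f) }
        ; *-identity = (λ { (a , b) → cong₂ _,_ (identity*₁ a b) (identity*₂ a b) })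
                     , (λ { (a , b) → cong₂ _,_ (identity*₃ a b) (identity*₄ a b) })
        ; distrib = (λ { (a , b) (c , d) (e , f) → cong₂ _,_ (distribˡ₁ a b c d e f) (distribˡ₂ a b c d e f) })
                  , (λ { (a , b) (c , d) (e , f) → cong₂ _,_ (distribʳ₁ a b c d e f) (distribʳ₂ a b c d e f) }) }
      ; *-comm = λ { (a , b) (c , d) → cong₂ _,_ (comm*₁ a b c d) (comm*₂ a b c d) } }
      where
      open Q using (_+_; _*_; -_)
      assoc+ : ∀ x y z → (x + y) + z ≡ x + (y + z)
      assoc+ = solve-∀ ℚ-ring
      identityˡ : ∀ x → 0ℚ + x ≡ x
      identityˡ = solve-∀ ℚ-ring
      identityʳ : ∀ x → x + 0ℚ ≡ x
      identityʳ = solve-∀ ℚ-ring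
      inverseˡ : ∀ x → - x + x ≡ 0ℚ
      inverseˡ = solve-∀ ℚ-ring
      inverseʳ : ∀ x → x + - x ≡ 0ℚ
      inverseʳ = solve-∀ ℚ-ring
      comm+ : ∀ x y → x + y ≡ y + x
      comm+ = solve-∀ ℚ-ring
      assoc*₁ : ∀ a b c d e f → (a * c + - (b * d)) * e + - ((a * d + b * c + b * d) * f)
                              ≡ a * (c * e + - (d * f)) + - (b * (c * f + d * e + d * f))
      assoc*₁ = solve-∀ ℚ-ring
      assoc*₂ : ∀ a b c d e f → (a * c + - (b * d)) * f + (a * d + b * c + b * d) * e + (a * d + b * c + b * d) * f
                              ≡ a * (c * f + d * e + d * f) + b * (c * e + - (d * f)) + b * (c * f + d * e + d * f)
      assoc*₂ = solve-∀ ℚ-ring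
      identity*₁ : ∀ a b → 1ℚ * a + - (0ℚ * b) ≡ a
      identity*₁ = solve-∀ ℚ-ring
      identity*₂ : ∀ a b → 1ℚ * b + 0ℚ * a + 0ℚ * b ≡ b
      identity*₂ = solve-∀ ℚ-ring
      identity*₃ : ∀ a b → a * 1ℚ + - (b * 0ℚ) ≡ a
      identity*₃ = solve-∀ ℚ-ring
      identity*₄ : ∀ a b → a * 0ℚ + b * 1ℚ + b * 0ℚ ≡ b
      identity*₄ = solve-∀ ℚ-ring
      distribˡ₁ : ∀ a b c d e f → a * (c + e) + - (b * (d + f)) ≡ (a * c + - (b * d)) + (a * e + - (b * f))
      distribˡ₁ = solve-∀ ℚ-ring
      distribˡ₂ : ∀ a b c d e f → a * (d + f) + b * (c + e) + b * (d + f) ≡ (a * d + b * c + b * d) + (a * f + b * e + b * f)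
      distribˡ₂ = solve-∀ ℚ-ring
      distribʳ₁ : ∀ a b c d e f → (c + e) * a + - ((d + f) * b) ≡ (c * a + - (d * b)) + (e * a + - (f * b))
      distribʳ₁ = solve-∀ ℚ-ring
      distribʳ₂ : ∀ a b c d e f → (c + e) * b + (d + f) * a + (d + f) * b ≡ (c * b + d * a + d * b) + (e * b + f * a + f * b)
      distribʳ₂ = solve-∀ ℚ-ring
      comm*₁ : ∀ a b c d → a * c + - (b * d) ≡ c * a + - (d * b)
      comm*₁ = solve-∀ ℚ-ring
      comm*₂ : ∀ a b c d → a * d + b * c + b * d ≡ c * b + d * a + d * b
      comm*₂ = solve-∀ ℚ-ring

  open PowerCombinations isCommutativeRing public

  ℚ[ω]-ring : AlmostCommutativeRing 0ℓ 0ℓ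
  ℚ[ω]-ring = fromCommutativeRing commutativeRing isZero
    where
    isZero : ∀ x → Maybe (0# ≡ x)
    isZero x with ≡-dec _≟ℚ_ _≟ℚ_ 0# x
    ... | yes 0≡x = just 0≡x
    ... | no _ = nothing

  ω ω̄ : ℚ[ω]
  ω = (0ℚ , 1ℚ)
  ω̄ = (1ℚ , Q.- 1ℚ)

module Embedding where

  open import Data.Rational as Q using (ℚ; 0ℚ; 1ℚ)
  import Data.Rational.Properties as Qₚ
  open import Data.Nat as ℕ using (ℕ; zero; suc; _<_; _≤_; _∸_)
  import Data.Nat.Properties as ℕₚ
  open import Data.Nat.Coprimality using (1-coprimeTo) renaming (sym to coprime-sym)
  open import Data.Integer as ℤ using (ℤ; +_; -[1+_]; _⊖_)
  open import Data.Integer.Properties using (⊖-≥)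
  import Data.Integer.Tactic.RingSolver as ℤ-Solver
  open import Data.Fin as Fin using (Fin; toℕ)
  open import Data.Product using (_,_; proj₁)
  open import Relation.Nullary using (¬_; yes; no)
  open import Function using (_∘_)
  open import Tactic.RingSolver using (solve-∀)
  import Defs as D
  open EisensteinRationals
  open ≡-Reasoning

  ↑_ : ℚ → ℚ[ω]
  ↑ x = (x , 0ℚ)

  ↑-injective : ∀ {x y} → ↑ x ≡ ↑ y → x ≡ y
  ↑-injective = cong proj₁

  ↑-+ : ∀ x y → ↑ (x Q.+ y) ≡ ↑ x + ↑ y
  ↑-+ x y = cong (x Q.+ y ,_) (sym (Qₚ.+-identityˡ 0ℚ))

  ↑-* : ∀ x y → ↑ (x Q.* y) ≡ ↑ x * ↑ y
  ↑-* x y = cong₂ _,_ (real x y) (imaginary x y)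
    where
    real : ∀ x y → x Q.* y ≡ x Q.* y Q.+ Q.- (0ℚ Q.* 0ℚ)
    real = solve-∀ ℚ-ring
    imaginary : ∀ x y → 0ℚ ≡ x Q.* 0ℚ Q.+ 0ℚ Q.* y Q.+ 0ℚ Q.* 0ℚ
    imaginary = solve-∀ ℚ-ring

  ↑-^ : ∀ x k → ↑ (x D.^ℚ k) ≡ ↑ x ^ k
  ↑-^ x zero = refl
  ↑-^ x (suc k) = trans (↑-* x (x D.^ℚ k)) (cong (↑ x *_) (↑-^ x k))

  ↑-ℕ→ℚ : ∀ k → ↑ (D.ℕ→ℚ k) ≡ k × 1#
  ↑-ℕ→ℚ zero = refl
  ↑-ℕ→ℚ (suc k) = trans (cong ↑_ (sym 1+k)) (trans (↑-+ 1ℚ (D.ℕ→ℚ k)) (cong (λ w → 1# + w) (↑-ℕ→ℚ k)))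
    where
    numerator : ∀ (x : ℤ) → (ℤ.1ℤ ℤ.* ℤ.1ℤ) ℤ.+ (x ℤ.* ℤ.1ℤ) ≡ ℤ.1ℤ ℤ.+ x
    numerator = ℤ-Solver.solve-∀
    1+k : 1ℚ Q.+ D.ℕ→ℚ k ≡ D.ℕ→ℚ (suc k)
    1+k = trans (cong (1ℚ Q.+_) (Qₚ.normalize-coprime (coprime-sym (1-coprimeTo k))))
      (cong (Q._/ 1) (numerator (+ k)))

  ↑-sumFin : ∀ k (h : Fin k → ℚ) (H : ℕ → ℚ[ω]) → (∀ j → ↑ h j ≡ H (toℕ j)) → ↑ D.sumFin k h ≡ sum k H
  ↑-sumFin zero h H _ = refl
  ↑-sumFin (suc k) h H h≡H = trans (↑-+ (h Fin.zero) (D.sumFin k (h ∘ Fin.suc)))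
    (cong₂ _+_ (h≡H Fin.zero) (↑-sumFin k (h ∘ Fin.suc) (H ∘ suc) (h≡H ∘ Fin.suc)))

  toℕ-punchIn : ∀ {n} (j : Fin (suc n)) (c : Fin n) → toℕ (Fin.punchIn j c) ≡ punchIn (toℕ j) (toℕ c)
  toℕ-punchIn Fin.zero c = refl
  toℕ-punchIn (Fin.suc j) Fin.zero = refl
  toℕ-punchIn (Fin.suc j) (Fin.suc c) = cong suc (toℕ-punchIn j c)

  ↑-det : ∀ k (M : Fin k → Fin k → ℚ) (N : Matrix) → (∀ r c → ↑ M r c ≡ N (toℕ r) (toℕ c)) →
    ↑ D.det k M ≡ det k N
  ↑-det zero M N _ = refl
  ↑-det (suc k) M N M≡N = ↑-sumFin (suc k) _ (λ j → sign j * N 0 j * det k (minor N 0 j)) λ j → begin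
    ↑ ((Q.- 1ℚ) D.^ℚ toℕ j Q.* M Fin.zero j Q.* D.det k (minorℚ j))
      ≡⟨ ↑-* ((Q.- 1ℚ) D.^ℚ toℕ j Q.* M Fin.zero j) (D.det k (minorℚ j)) ⟩
    ↑ ((Q.- 1ℚ) D.^ℚ toℕ j Q.* M Fin.zero j) * ↑ D.det k (minorℚ j)
      ≡⟨ cong₂ _*_
           (trans (↑-* ((Q.- 1ℚ) D.^ℚ toℕ j) (M Fin.zero j)) (cong₂ _*_ (↑-^ (Q.- 1ℚ) (toℕ j)) (M≡N Fin.zero j)))
           (↑-det k (minorℚ j) (minor N 0 (toℕ j)) λ r c →
             trans (M≡N (Fin.suc r) (Fin.punchIn j c)) (cong (N (suc (toℕ r))) (toℕ-punchIn j c))) ⟩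
    sign (toℕ j) * N 0 (toℕ j) * det k (minor N 0 (toℕ j)) ∎
    where
    minorℚ : Fin (suc k) → Fin k → Fin k → ℚ
    minorℚ j r c = M (Fin.suc r) (Fin.punchIn j c)

  extend : (ℕ → ℚ) → Poly
  extend P (+ i) = ↑ P i
  extend P -[1+ i ] = 0#

  -- Entries of D.sylvester inside, right of and left of the band of coefficients of P (degree d, shift s).
  extend-inBand : ∀ d s c P {t} → d ℕ.+ s ≡ t → s ≤ c → c ∸ s ≤ d → extend P (t ⊖ c) ≡ ↑ P (d ∸ (c ∸ s))
  extend-inBand d s c P refl s≤c c∸s≤d = trans (cong (extend P) (⊖-≥ c≤d+s)) (cong (↑_ ∘ P) d+s∸c)
    where
    s+[c∸s]≡c : s ℕ.+ (c ∸ s) ≡ c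
    s+[c∸s]≡c = ℕₚ.m+[n∸m]≡n s≤c
    c≤d+s : c ≤ d ℕ.+ s
    c≤d+s = ℕₚ.≤-trans (ℕₚ.≤-reflexive (sym s+[c∸s]≡c))
      (ℕₚ.≤-trans (ℕₚ.+-monoʳ-≤ s c∸s≤d) (ℕₚ.≤-reflexive (ℕₚ.+-comm s d)))
    d+s∸c : (d ℕ.+ s) ∸ c ≡ d ∸ (c ∸ s)
    d+s∸c = trans (cong₂ _∸_ (ℕₚ.+-comm d s) (sym s+[c∸s]≡c)) (ℕₚ.[m+n]∸[m+o]≡n∸o s d (c ∸ s))

  extend-rightOfBand : ∀ d s c P {t} → d ℕ.+ s ≡ t → s ≤ c → ¬ (c ∸ s ≤ d) → extend P (t ⊖ c) ≡ 0#
  extend-rightOfBand d s c P refl s≤c c∸s≰d with m<n⇒m⊖n≡-[1+_] (d ℕ.+ s) c d+s<c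
    where
    d+s<c : d ℕ.+ s < c
    d+s<c = subst (d ℕ.+ s <_) (trans (ℕₚ.+-comm (c ∸ s) s) (ℕₚ.m+[n∸m]≡n s≤c))
      (ℕₚ.+-monoˡ-< s (ℕₚ.≰⇒> c∸s≰d))
  ... | _ , eq = cong (extend P) eq

  extend-leftOfBand : ∀ d s c P {t} → d ℕ.+ s ≡ t → (∀ i → d < i → P i ≡ 0ℚ) → ¬ (s ≤ c) →
    extend P (t ⊖ c) ≡ 0#
  extend-leftOfBand d s c P refl degree s≰c = trans (cong (extend P) (⊖-≥ c≤d+s)) (cong ↑_ (degree _ d<d+s∸c))
    where
    c<s : c < s
    c<s = ℕₚ.≰⇒> s≰c
    c≤d+s : c ≤ d ℕ.+ s
    c≤d+s = ℕₚ.≤-trans (ℕₚ.<⇒≤ c<s) (ℕₚ.m≤n+m s d)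
    d<d+s∸c : d < (d ℕ.+ s) ∸ c
    d<d+s∸c = subst (d <_) (sym (ℕₚ.+-∸-assoc d (ℕₚ.<⇒≤ c<s))) (ℕₚ.m<m+n d (ℕₚ.m<n⇒0<n∸m c<s))

  ↑-sylvester : ∀ k l A B → (∀ i → k < i → A i ≡ 0ℚ) → (∀ i → l < i → B i ≡ 0ℚ) →
    ∀ r c → ↑ D.sylvester k l A B r c ≡ sylvesterMatrix k l (extend A) (extend B) (toℕ r) (toℕ c)
  ↑-sylvester k l A B degreeA degreeB r c with toℕ r ℕ.<? l
  ... | yes r<l with toℕ r ℕ.≤? toℕ c
  ...   | no r≰c = sym (extend-leftOfBand k (toℕ r) (toℕ c) A refl degreeA r≰c)
  ...   | yes r≤c with toℕ c ∸ toℕ r ℕ.≤? k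
  ...     | yes inBand = sym (extend-inBand k (toℕ r) (toℕ c) A refl r≤c inBand)
  ...     | no outOfBand = sym (extend-rightOfBand k (toℕ r) (toℕ c) A refl r≤c outOfBand)
  ↑-sylvester k l A B degreeA degreeB r c | no r≮l with toℕ r ∸ l ℕ.≤? toℕ c
  ...   | no r∸l≰c = sym (extend-leftOfBand l (toℕ r ∸ l) (toℕ c) B (ℕₚ.m+[n∸m]≡n (ℕₚ.≮⇒≥ r≮l)) degreeB r∸l≰c)
  ...   | yes r∸l≤c with toℕ c ∸ (toℕ r ∸ l) ℕ.≤? l
  ...     | yes inBand = sym (extend-inBand l (toℕ r ∸ l) (toℕ c) B (ℕₚ.m+[n∸m]≡n (ℕₚ.≮⇒≥ r≮l)) r∸l≤c inBand)
  ...     | no outOfBand = sym (extend-rightOfBand l (toℕ r ∸ l) (toℕ c) B (ℕₚ.m+[n∸m]≡n (ℕₚ.≮⇒≥ r≮l)) r∸l≤c outOfBand)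

  ↑-res : ∀ k l A B → (∀ i → k < i → A i ≡ 0ℚ) → (∀ i → l < i → B i ≡ 0ℚ) →
    ↑ D.res k l A B ≡ resultant k l (extend A) (extend B)
  ↑-res k l A B degreeA degreeB = ↑-det (k ℕ.+ l) _ _ (↑-sylvester k l A B degreeA degreeB)

module ClosedForms where

  open import Data.Rational as Q using (ℚ; 0ℚ; 1ℚ)
  open import Data.Nat as ℕ using (ℕ; zero; suc; _<_; _∸_)
  import Data.Nat.Properties as ℕₚ
  import Data.Nat.Tactic.RingSolver as ℕ-Solver
  open import Data.Nat.DivMod using (m*n/n≡m)
  open import Data.Nat.Combinatorics using (_C_)
  open import Data.Integer using (+_; -[1+_])
  open import Relation.Nullary using (yes; no; contradiction)
  open import Tactic.RingSolver using (solve-∀)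
  open import Tactic.RingSolver.Core.AlmostCommutativeRing using (AlmostCommutativeRing)
  import Defs as D
  open EisensteinRationals
  open Embedding
  open ≡-Reasoning
  open AlmostCommutativeRing ℚ[ω]-ring using () renaming (_+_ to _⊕_; _*_ to _⊛_; -_ to ⊝_; 1# to 𝟙)

  third : ℚ
  third = + 1 Q./ 3

  module _ (m : ℚ) where

    x y : ℚ
    x = (1ℚ Q.+ Q.- m) Q.* third
    y = (1ℚ Q.+ + 2 Q./ 1 Q.* m) Q.* third

    -- D.g m i = a * ω ^ i + b * ω̄ ^ i: both sides satisfy u (i + 2) = u (i + 1) - u i (as ω² = ω - 1),
    -- and x, y are chosen so that they agree at i = 0 and i = 1.
    a b : ℚ[ω]
    a = ↑ x + ↑ y * ω
    b = ↑ x + ↑ y * ω̄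

    x+x+y≡1 : x Q.+ x Q.+ y ≡ 1ℚ
    x+x+y≡1 = identity m
      where
      identity : ∀ m → (1ℚ Q.+ Q.- m) Q.* third Q.+ (1ℚ Q.+ Q.- m) Q.* third Q.+ (1ℚ Q.+ + 2 Q./ 1 Q.* m) Q.* third ≡ 1ℚ
      identity = solve-∀ ℚ-ring

    x-y≡-m : x Q.+ Q.- y ≡ Q.- m
    x-y≡-m = identity m
      where
      identity : ∀ m → (1ℚ Q.+ Q.- m) Q.* third Q.+ Q.- ((1ℚ Q.+ + 2 Q./ 1 Q.* m) Q.* third) ≡ Q.- m
      identity = solve-∀ ℚ-ring

    x²+xy+y²≡μ/3 : x Q.* x Q.+ x Q.* y Q.+ y Q.* y ≡ (m Q.* m Q.+ m Q.+ 1ℚ) Q.* third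
    x²+xy+y²≡μ/3 = identity m
      where
      identity : ∀ m → (1ℚ Q.+ Q.- m) Q.* third Q.* ((1ℚ Q.+ Q.- m) Q.* third)
                         Q.+ (1ℚ Q.+ Q.- m) Q.* third Q.* ((1ℚ Q.+ + 2 Q./ 1 Q.* m) Q.* third)
                         Q.+ (1ℚ Q.+ + 2 Q./ 1 Q.* m) Q.* third Q.* ((1ℚ Q.+ + 2 Q./ 1 Q.* m) Q.* third)
                     ≡ (m Q.* m Q.+ m Q.+ 1ℚ) Q.* third
      identity = solve-∀ ℚ-ring

    a+b≡1 : a + b ≡ 1#
    a+b≡1 = begin
      (↑ x + ↑ y * ω) + (↑ x + ↑ y * ω̄) ≡⟨ expand (↑ x) (↑ y) ⟩
      ↑ x + ↑ x + ↑ y                   ≡⟨ trans (↑-+ (x Q.+ x) y) (cong (_+ ↑ y) (↑-+ x x)) ⟨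
      ↑ (x Q.+ x Q.+ y)                 ≡⟨ cong ↑_ x+x+y≡1 ⟩
      1#                                ∎
      where
      expand : ∀ X Y → (X ⊕ Y ⊛ ω) ⊕ (X ⊕ Y ⊛ ω̄) ≡ X ⊕ X ⊕ Y
      expand = solve-∀ ℚ[ω]-ring

    a*b≡μ/3 : a * b ≡ ↑ ((m Q.* m Q.+ m Q.+ 1ℚ) Q.* third)
    a*b≡μ/3 = begin
      (↑ x + ↑ y * ω) * (↑ x + ↑ y * ω̄)     ≡⟨ expand (↑ x) (↑ y) ⟩
      ↑ x * ↑ x + ↑ x * ↑ y + ↑ y * ↑ y      ≡⟨ cong₂ _+_ (cong₂ _+_ (↑-* x x) (↑-* x y)) (↑-* y y) ⟨
      ↑ (x Q.* x) + ↑ (x Q.* y) + ↑ (y Q.* y)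
        ≡⟨ trans (↑-+ (x Q.* x Q.+ x Q.* y) (y Q.* y)) (cong (_+ ↑ (y Q.* y)) (↑-+ (x Q.* x) (x Q.* y))) ⟨
      ↑ (x Q.* x Q.+ x Q.* y Q.+ y Q.* y)   ≡⟨ cong ↑_ x²+xy+y²≡μ/3 ⟩
      ↑ ((m Q.* m Q.+ m Q.+ 1ℚ) Q.* third)   ∎
      where
      expand : ∀ X Y → (X ⊕ Y ⊛ ω) ⊛ (X ⊕ Y ⊛ ω̄) ≡ X ⊛ X ⊕ X ⊛ Y ⊕ Y ⊛ Y
      expand = solve-∀ ℚ[ω]-ring

    g-recurrence : ∀ j → D.g m (2 ℕ.+ j) ≡ D.g m (suc j) Q.+ Q.- D.g m j
    g-recurrence 0 = refl
    g-recurrence 1 = identity m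
      where
      identity : ∀ m → Q.- 1ℚ ≡ (Q.- m Q.+ Q.- 1ℚ) Q.+ Q.- (Q.- m)
      identity = solve-∀ ℚ-ring
    g-recurrence 2 = identity m
      where
      identity : ∀ m → m ≡ Q.- 1ℚ Q.+ Q.- (Q.- m Q.+ Q.- 1ℚ)
      identity = solve-∀ ℚ-ring
    g-recurrence 3 = identity m
      where
      identity : ∀ m → m Q.+ 1ℚ ≡ m Q.+ Q.- (Q.- 1ℚ)
      identity = solve-∀ ℚ-ring
    g-recurrence 4 = identity m
      where
      identity : ∀ m → 1ℚ ≡ (m Q.+ 1ℚ) Q.+ Q.- m
      identity = solve-∀ ℚ-ring
    g-recurrence 5 = identity m
      where
      identity : ∀ m → Q.- m ≡ 1ℚ Q.+ Q.- (m Q.+ 1ℚ)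
      identity = solve-∀ ℚ-ring
    g-recurrence (suc (suc (suc (suc (suc (suc j)))))) = g-recurrence j

    g-closedForm : ∀ j → ↑ D.g m j ≡ a * ω ^ j + b * ω̄ ^ j
    g-closedForm 0 = trans (cong ↑_ (sym x+x+y≡1)) (trans (↑-+ (x Q.+ x) y) (trans (cong (_+ ↑ y) (↑-+ x x))
      (sym (atZero (↑ x) (↑ y)))))
      where
      atZero : ∀ X Y → (X ⊕ Y ⊛ ω) ⊛ 𝟙 ⊕ (X ⊕ Y ⊛ ω̄) ⊛ 𝟙 ≡ X ⊕ X ⊕ Y
      atZero = solve-∀ ℚ[ω]-ring
    g-closedForm 1 = trans (cong ↑_ (sym x-y≡-m)) (trans (↑-+ x (Q.- y)) (sym (atOne (↑ x) (↑ y))))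
      where
      atOne : ∀ X Y → (X ⊕ Y ⊛ ω) ⊛ (ω ⊛ 𝟙) ⊕ (X ⊕ Y ⊛ ω̄) ⊛ (ω̄ ⊛ 𝟙) ≡ X ⊕ ⊝ Y
      atOne = solve-∀ ℚ[ω]-ring
    g-closedForm (suc (suc j)) = begin
      ↑ D.g m (2 ℕ.+ j)                              ≡⟨ cong ↑_ (g-recurrence j) ⟩
      ↑ (D.g m (suc j) Q.+ Q.- D.g m j)              ≡⟨ ↑-+ (D.g m (suc j)) (Q.- D.g m j) ⟩
      ↑ D.g m (suc j) + - ↑ D.g m j                  ≡⟨ cong₂ (λ u v → u + - v) (g-closedForm (suc j)) (g-closedForm j) ⟩
      (a * ω ^ suc j + b * ω̄ ^ suc j) + - (a * ω ^ j + b * ω̄ ^ j) ≡⟨ recurrence a b (ω ^ j) (ω̄ ^ j) ⟨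
      a * ω ^ (2 ℕ.+ j) + b * ω̄ ^ (2 ℕ.+ j)          ∎
      where
      recurrence : ∀ A B p q →
        A ⊛ (ω ⊛ (ω ⊛ p)) ⊕ B ⊛ (ω̄ ⊛ (ω̄ ⊛ q)) ≡ (A ⊛ (ω ⊛ p) ⊕ B ⊛ (ω̄ ⊛ q)) ⊕ ⊝ (A ⊛ p ⊕ B ⊛ q)
      recurrence = solve-∀ ℚ[ω]-ring

    f-degree : ∀ n i → n < i → D.f m n i ≡ 0ℚ
    f-degree n i n<i with i ℕ.≤? n
    ... | yes i≤n = contradiction i≤n (ℕₚ.<⇒≱ n<i)
    ... | no _ = refl

    f-closedForm : ∀ n z → extend (D.f m n) z ≡ powerCombination a b ω ω̄ n z
    f-closedForm n -[1+ i ] = sym (powerCombination-noNegativePowers a b ω ω̄ n i)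
    f-closedForm n (+ i) with i ℕ.≤? n
    ... | no i≰n = sym (powerCombination-degree a b ω ω̄ n i (ℕₚ.≰⇒> i≰n))
    ... | yes i≤n = begin
      ↑ (D.ℕ→ℚ (n C i) Q.* D.g m (n ∸ i))              ≡⟨ ↑-* (D.ℕ→ℚ (n C i)) (D.g m (n ∸ i)) ⟩
      ↑ D.ℕ→ℚ (n C i) * ↑ D.g m (n ∸ i)                ≡⟨ cong₂ _*_ (↑-ℕ→ℚ (n C i)) (g-closedForm (n ∸ i)) ⟩
      (n C i) × 1# * (a * ω ^ (n ∸ i) + b * ω̄ ^ (n ∸ i)) ≡⟨ distribute ((n C i) × 1#) (ω ^ (n ∸ i)) (ω̄ ^ (n ∸ i)) ⟩
      a * ((n C i) × 1# * ω ^ (n ∸ i)) + b * ((n C i) × 1# * ω̄ ^ (n ∸ i))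
        ≡⟨ cong₂ (λ u v → a * u + b * v) (linearPower-coefficient ω n i i≤n) (linearPower-coefficient ω̄ n i i≤n) ⟨
      powerCombination a b ω ω̄ n (+ i)                  ∎
      where
      distribute : ∀ c p q → c * (a * p + b * q) ≡ a * (c * p) + b * (c * q)
      distribute = solve 5 (λ a b c p q → c :* (a :* p :+ b :* q) := a :* (c :* p) :+ b :* (c :* q)) refl a b

  triangle : ℕ → ℕ
  triangle zero = 0
  triangle (suc k) = triangle k ℕ.+ suc k

  k+k*k≡2*triangle : ∀ k → k ℕ.+ k ℕ.* k ≡ 2 ℕ.* triangle k
  k+k*k≡2*triangle zero = refl
  k+k*k≡2*triangle (suc k) = trans (step k)
    (trans (cong (λ t → t ℕ.+ 2 ℕ.* suc k) (k+k*k≡2*triangle k)) (sym (ℕₚ.*-distribˡ-+ 2 (triangle k) (suc k))))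
    where
    step : ∀ k → suc k ℕ.+ suc k ℕ.* suc k ≡ (k ℕ.+ k ℕ.* k) ℕ.+ 2 ℕ.* suc k
    step = ℕ-Solver.solve-∀

  [1+k]*k/2≡triangle : ∀ k → (suc k ℕ.* k) ℕ./ 2 ≡ triangle k
  [1+k]*k/2≡triangle k =
    trans (cong (ℕ._/ 2) (trans (k+k*k≡2*triangle k) (ℕₚ.*-comm 2 (triangle k)))) (m*n/n≡m (triangle k) 2)

  module _ (m : ℚ) (j : ℕ) where

    private
      k = suc j
      μ = m Q.* m Q.+ m Q.+ 1ℚ
      δ = ω + - ω̄
      three = 3 × 1#

      powersOfB : (b m * (- 1# * δ) ^ k) ^ k ≡ b m ^ k * ((- 1#) ^ (k ℕ.* k) * δ ^ (k ℕ.* k))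
      powersOfB = begin
        (b m * (- 1# * δ) ^ k) ^ k            ≡⟨ ^-distrib-* (b m) _ k ⟩
        b m ^ k * ((- 1# * δ) ^ k) ^ k        ≡⟨ cong (b m ^ k *_) (^-assocʳ (- 1# * δ) k k) ⟩
        b m ^ k * (- 1# * δ) ^ (k ℕ.* k)      ≡⟨ cong (b m ^ k *_) (^-distrib-* (- 1#) δ (k ℕ.* k)) ⟩
        b m ^ k * ((- 1#) ^ (k ℕ.* k) * δ ^ (k ℕ.* k)) ∎

      signsCancel : sign k * (- 1#) ^ (k ℕ.* k) ≡ 1#
      signsCancel = begin
        sign k * (- 1#) ^ (k ℕ.* k)     ≡⟨ ^-homo-* (- 1#) k (k ℕ.* k) ⟨
        (- 1#) ^ (k ℕ.+ k ℕ.* k)        ≡⟨ cong ((- 1#) ^_) (k+k*k≡2*triangle k) ⟩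
        (- 1#) ^ (2 ℕ.* triangle k)     ≡⟨ ^-assocʳ (- 1#) 2 (triangle k) ⟨
        ((- 1#) ^ 2) ^ triangle k       ≡⟨ 1#^n≡1# (triangle k) ⟩
        1#                              ∎

      -- δ² = -3
      powersOfδ : δ ^ (k ℕ.* k) * δ ^ k ≡ (- 1#) ^ triangle k * (three ^ triangle j * three ^ k)
      powersOfδ = begin
        δ ^ (k ℕ.* k) * δ ^ k             ≡⟨ ^-homo-* δ (k ℕ.* k) k ⟨
        δ ^ (k ℕ.* k ℕ.+ k)               ≡⟨ cong (δ ^_) (trans (ℕₚ.+-comm (k ℕ.* k) k) (k+k*k≡2*triangle k)) ⟩
        δ ^ (2 ℕ.* triangle k)            ≡⟨ ^-assocʳ δ 2 (triangle k) ⟨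
        (- 1# * three) ^ triangle k       ≡⟨ ^-distrib-* (- 1#) three (triangle k) ⟩
        (- 1#) ^ triangle k * three ^ (triangle j ℕ.+ k) ≡⟨ cong ((- 1#) ^ triangle k *_) (^-homo-* three (triangle j) k) ⟩
        (- 1#) ^ triangle k * (three ^ triangle j * three ^ k) ∎

      thirdsCancel : ↑ third ^ k * three ^ k ≡ 1#
      thirdsCancel = trans (sym (^-distrib-* (↑ third) three k)) (1#^n≡1# k)

      rightHandSide : ↑ (μ D.^ℚ k Q.* D.ℕ→ℚ 3 D.^ℚ ((k ℕ.* j) ℕ./ 2) Q.* (Q.- 1ℚ) D.^ℚ ((suc k ℕ.* k) ℕ./ 2))
                      ≡ ↑ μ ^ k * three ^ triangle j * (- 1#) ^ triangle k
      rightHandSide = begin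
        ↑ (μ D.^ℚ k Q.* D.ℕ→ℚ 3 D.^ℚ e₃ Q.* (Q.- 1ℚ) D.^ℚ e₋₁)
          ≡⟨ trans (↑-* (μ D.^ℚ k Q.* D.ℕ→ℚ 3 D.^ℚ e₃) ((Q.- 1ℚ) D.^ℚ e₋₁))
               (cong (_* ↑ ((Q.- 1ℚ) D.^ℚ e₋₁)) (↑-* (μ D.^ℚ k) (D.ℕ→ℚ 3 D.^ℚ e₃))) ⟩
        ↑ (μ D.^ℚ k) * ↑ (D.ℕ→ℚ 3 D.^ℚ e₃) * ↑ ((Q.- 1ℚ) D.^ℚ e₋₁)
          ≡⟨ cong₂ _*_ (cong₂ _*_ (↑-^ μ k) (↑-^ (D.ℕ→ℚ 3) e₃)) (↑-^ (Q.- 1ℚ) e₋₁) ⟩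
        ↑ μ ^ k * ↑ (D.ℕ→ℚ 3) ^ e₃ * (- 1#) ^ e₋₁
          ≡⟨ cong₂ (λ u v → ↑ μ ^ k * u * (- 1#) ^ v)
               (cong₂ _^_ (↑-ℕ→ℚ 3) ([1+k]*k/2≡triangle j)) ([1+k]*k/2≡triangle k) ⟩
        ↑ μ ^ k * three ^ triangle j * (- 1#) ^ triangle k ∎
        where
        e₃ = (k ℕ.* j) ℕ./ 2
        e₋₁ = (suc k ℕ.* k) ℕ./ 2

    resultant-closedForm :
      sign k * (a m + b m) * ((b m * (- ω + ω̄) ^ k) ^ k * (a m * (ω + - ω̄)) ^ k)
        ≡ ↑ (μ D.^ℚ k Q.* D.ℕ→ℚ 3 D.^ℚ ((k ℕ.* j) ℕ./ 2) Q.* (Q.- 1ℚ) D.^ℚ ((suc k ℕ.* k) ℕ./ 2))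
    resultant-closedForm = begin
      sign k * (a m + b m) * ((b m * (- 1# * δ) ^ k) ^ k * (a m * δ) ^ k)
        ≡⟨ cong₂ (λ s u → sign k * s * u) (a+b≡1 m) (cong₂ _*_ powersOfB (^-distrib-* (a m) δ k)) ⟩
      sign k * 1# * ((b m ^ k * ((- 1#) ^ (k ℕ.* k) * δ ^ (k ℕ.* k))) * (a m ^ k * δ ^ k))
        ≡⟨ solve 6 (λ s bk sk dk ak d → s :* con 1 :* ((bk :* (sk :* dk)) :* (ak :* d)) := (ak :* bk) :* ((s :* sk) :* (dk :* d)))
             refl (sign k) (b m ^ k) ((- 1#) ^ (k ℕ.* k)) (δ ^ (k ℕ.* k)) (a m ^ k) (δ ^ k) ⟩
      (a m ^ k * b m ^ k) * ((sign k * (- 1#) ^ (k ℕ.* k)) * (δ ^ (k ℕ.* k) * δ ^ k))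
        ≡⟨ cong₂ (λ u v → u * (v * (δ ^ (k ℕ.* k) * δ ^ k)))
             (trans (sym (^-distrib-* (a m) (b m) k)) (cong (_^ k) (a*b≡μ/3 m)))
             signsCancel ⟩
      ↑ (μ Q.* third) ^ k * (1# * (δ ^ (k ℕ.* k) * δ ^ k))
        ≡⟨ cong₂ _*_ (trans (cong (_^ k) (↑-* μ third)) (^-distrib-* (↑ μ) (↑ third) k)) (trans (*-identityˡ _) powersOfδ) ⟩
      (↑ μ ^ k * ↑ third ^ k) * ((- 1#) ^ triangle k * (three ^ triangle j * three ^ k))
        ≡⟨ solve 5 (λ u t s h v → (u :* t) :* (s :* (h :* v)) := u :* h :* s :* (t :* v))
             refl (↑ μ ^ k) (↑ third ^ k) ((- 1#) ^ triangle k) (three ^ triangle j) (three ^ k) ⟩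
      ↑ μ ^ k * three ^ triangle j * (- 1#) ^ triangle k * (↑ third ^ k * three ^ k)
        ≡⟨ trans (cong (↑ μ ^ k * three ^ triangle j * (- 1#) ^ triangle k *_) thirdsCancel) (*-identityʳ _) ⟩
      ↑ μ ^ k * three ^ triangle j * (- 1#) ^ triangle k
        ≡⟨ rightHandSide ⟨
      ↑ (μ D.^ℚ k Q.* D.ℕ→ℚ 3 D.^ℚ ((k ℕ.* j) ℕ./ 2) Q.* (Q.- 1ℚ) D.^ℚ ((suc k ℕ.* k) ℕ./ 2)) ∎

open import Defs
open import Data.Nat using (ℕ; _≤_; _∸_; _/_)
import Data.Nat as ℕ
open import Data.Rational using (ℚ; 1ℚ; _+_; _*_; -_)
open EisensteinRationals using (resultant; resultant-cong; powerCombination; resultant-powerCombination; ω; ω̄)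
open Embedding using (↑_; ↑-injective; extend; ↑-res)
open ClosedForms using (a; b; f-degree; f-closedForm; resultant-closedForm)
open ≡-Reasoning

mainTheorem6 : (m : ℚ) (n : ℕ) → 2 ≤ n →
    res n (n ∸ 1) (f m n) (f m (n ∸ 1))
    ≡ ((m * m + m + 1ℚ) ^ℚ (n ∸ 1))
    * (ℕ→ℚ 3 ^ℚ (((n ∸ 1) ℕ.* (n ∸ 2)) / 2))
    * ((- 1ℚ) ^ℚ ((n ℕ.* (n ∸ 1)) / 2))
mainTheorem6 m (ℕ.suc (ℕ.suc j)) (ℕ.s≤s (ℕ.s≤s _)) = ↑-injective (begin
  ↑ res n k (f m n) (f m k)                         ≡⟨ ↑-res n k (f m n) (f m k) (f-degree m n) (f-degree m k) ⟩
  resultant n k (extend (f m n)) (extend (f m k))   ≡⟨ resultant-cong n k (f-closedForm m n) (f-closedForm m k) ⟩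
  resultant n k (F n) (F k)                         ≡⟨ resultant-powerCombination (a m) (b m) ω ω̄ k ⟩
  _                                                 ≡⟨ resultant-closedForm m j ⟩
  _                                                 ∎)
  where
  n = 2 ℕ.+ j
  k = 1 ℕ.+ j
  F = powerCombination (a m) (b m) ω ω̄
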